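{- Let $S$ be a connected colorful graph with at least one edge, let $e^*\in E(S)$, and let $\mathbf{X}(S)=\big(\Gamma(S,\chi_{\emptyset})-\Gamma(S,\chi_{e^*})\big)/2^{|E(S)|-|V(S)|+1}$. Then $\hom(S,\mathbf{X}(S))=1$.
   Context: Graphs are finite, undirected, vertex-colored; homomorphisms preserve edges and colors, $\hom(H,G)$ counts them, and $\hom$ is extended linearly to formal $\mathbb{Q}$-linear combinations of graphs (quantum graphs). A colorful graph $S$ has color set $V(S)$ with identity coloring. For $v\in V(S)$ let $I(v)$ be the set of edges of $S$ incident with $v$, and let $A_v$ be the set of even assignments in $\{0,1\}^{I(v)}$ (those with an even number of $1$s). For $c\in\{0,1\}^{E(S)}$, $\Gamma(S,c)$ is the colored graph whose vertices of color $v$ are the elements of $A_v$ (for each $v\in V(S)$), and for each edge $uv\in E(S)$, $a_u\in A_u$ and $a_v\in A_v$ are adjacent iff $a_u(uv)\equiv a_v(uv)+c(uv)\pmod 2$; there are no other edges. For $F\subseteq E(S)$, $\chi_F\in\{0,1\}^{E(S)}$ is $1$ exactly on $F$; $\chi_e=\chi_{\{e\}}$. -}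

module Defs where

open import Data.Bool using (Bool; true; false; _∧_; _∨_; not; _xor_; if_then_else_)
open import Data.Nat using (ℕ; zero; suc; _+_; _∸_; _^_; _<ᵇ_)
open import Data.Nat.Properties using (m^n≢0)
open import Data.Fin using (Fin; toℕ)
open import Data.Fin.Properties using (_≟_)
open import Data.Vec using (Vec; []; _∷_; lookup)
open import Data.List using (List; []; _∷_; [_]; map; concatMap; filterᵇ; length; allFin; foldr)
open import Data.Product using (_×_; _,_; proj₁; proj₂)
open import Data.Integer using (ℤ; +_; -_)
open import Data.Rational using (ℚ; _/_; 0ℚ) renaming (_+_ to _+ℚ_; _*_ to _*ℚ_)
open import Relation.Binary.PropositionalEquality using (_≡_)
open import Relation.Binary.Definitions using (DecidableEquality)
open import Relation.Nullary.Decidable using (⌊_⌋)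

-- Finite vertex-colored graphs.  Vertices are Fin n, colors in C,
-- adjacency is a Boolean relation (symmetric for all graphs we build).

record CGraph (C : Set) : Set where
  field
    size : ℕ
    col  : Fin size → C
    adj  : Fin size → Fin size → Bool
open CGraph public

all : {A : Set} → (A → Bool) → List A → Bool
all p = foldr (λ x b → p x ∧ b) true

allVecs : (m n : ℕ) → List (Vec (Fin m) n)
allVecs m zero    = [ [] ]
allVecs m (suc n) = concatMap (λ i → map (i ∷_) (allVecs m n)) (allFin m)

isHom : {C : Set} → DecidableEquality C → (H G : CGraph C) →
        Vec (Fin (size G)) (size H) → Bool
isHom eq H G f =
  all (λ x → ⌊ eq (col G (lookup f x)) (col H x) ⌋) (allFin (size H)) ∧
  all (λ x → all (λ y → not (adj H x y) ∨ adj G (lookup f x) (lookup f y))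
                 (allFin (size H)))
      (allFin (size H))

hom : {C : Set} → DecidableEquality C → CGraph C → CGraph C → ℕ
hom eq H G = length (filterᵇ (isHom eq H G) (allVecs (size G) (size H)))

-- quantum graphs: formal ℚ-linear combinations of graphs
QGraph : Set → Set
QGraph C = List (ℚ × CGraph C)

homQ : {C : Set} → DecidableEquality C → CGraph C → QGraph C → ℚ
homQ eq H X = foldr (λ qG acc → (proj₁ qG *ℚ ((+ hom eq H (proj₂ qG)) / 1)) +ℚ acc) 0ℚ X

Symmetric : {n : ℕ} → (Fin n → Fin n → Bool) → Set
Symmetric {n} a = (u v : Fin n) → a u v ≡ a v u

Irreflexive : {n : ℕ} → (Fin n → Fin n → Bool) → Set
Irreflexive {n} a = (u : Fin n) → a u u ≡ false

data Reach {n : ℕ} (a : Fin n → Fin n → Bool) : Fin n → Fin n → Set where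
  here : ∀ {u} → Reach a u u
  step : ∀ {u w v} → a u w ≡ true → Reach a w v → Reach a u v

Connected : {n : ℕ} → (Fin n → Fin n → Bool) → Set
Connected {n} a = (u v : Fin n) → Reach a u v

-- E(S): unordered edges, listed as pairs (u,v) with u < v
edges : {n : ℕ} → (Fin n → Fin n → Bool) → List (Fin n × Fin n)
edges {n} a =
  filterᵇ (λ p → (toℕ (proj₁ p) <ᵇ toℕ (proj₂ p)) ∧ a (proj₁ p) (proj₂ p))
          (concatMap (λ u → map (u ,_) (allFin n)) (allFin n))

colorful : {n : ℕ} → (Fin n → Fin n → Bool) → CGraph (Fin n)
colorful {n} a = record { size = n ; col = λ v → v ; adj = a }

-- An assignment in {0,1}^{I(v)} is encoded as a : Vec Bool n with
-- a[w] = value on the edge vw for neighbours w of v, and a[w] = false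
-- for non-neighbours w (so this is a bijection with {0,1}^{I(v)}).
-- An edge labelling c ∈ {0,1}^{E(S)} is encoded as a symmetric function
-- c : Fin n → Fin n → Bool, c u v = value on the edge uv.

allBoolVecs : (n : ℕ) → List (Vec Bool n)
allBoolVecs zero    = [ [] ]
allBoolVecs (suc n) = concatMap (λ b → map (b ∷_) (allBoolVecs n)) (true ∷ false ∷ [])

countTrue : {k : ℕ} → Vec Bool k → ℕ
countTrue []            = 0
countTrue (true ∷ xs)   = suc (countTrue xs)
countTrue (false ∷ xs)  = countTrue xs

isEven : ℕ → Bool
isEven zero          = true
isEven (suc zero)    = false
isEven (suc (suc k)) = isEven k

evenAssignments : {n : ℕ} → (Fin n → Fin n → Bool) → Fin n → List (Vec Bool n)
evenAssignments {n} a v =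
  filterᵇ (λ x → all (λ w → a v w ∨ not (lookup x w)) (allFin n) ∧ isEven (countTrue x))
          (allBoolVecs n)

ΓVerts : {n : ℕ} → (Fin n → Fin n → Bool) → List (Fin n × Vec Bool n)
ΓVerts {n} a = concatMap (λ v → map (v ,_) (evenAssignments a v)) (allFin n)

Γ : {n : ℕ} → (a : Fin n → Fin n → Bool) → (c : Fin n → Fin n → Bool) → CGraph (Fin n)
Γ {n} a c = record
  { size = length (ΓVerts a)
  ; col  = λ k → proj₁ (Data.List.lookup (ΓVerts a) k)
  ; adj  = λ k l →
      let (u , au) = Data.List.lookup (ΓVerts a) k
          (v , av) = Data.List.lookup (ΓVerts a) l
      in a u v ∧ not (lookup au v xor (lookup av u xor c u v))
  }

χ∅ : {n : ℕ} → Fin n → Fin n → Bool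
χ∅ u v = false

χ : {n : ℕ} → Fin n → Fin n → Fin n → Fin n → Bool
χ i j u v = (⌊ u ≟ i ⌋ ∧ ⌊ v ≟ j ⌋) ∨ (⌊ u ≟ j ⌋ ∧ ⌊ v ≟ i ⌋)

-- X(S) = (Γ(S,χ_∅) − Γ(S,χ_{e*})) / 2^{|E(S)|−|V(S)|+1}
-- (for connected S, |E|+1 ≥ |V|, so the truncated subtraction is exact)
cycleRank : {n : ℕ} → (Fin n → Fin n → Bool) → ℕ
cycleRank {n} a = length (edges a) + 1 ∸ n

X : {n : ℕ} → (a : Fin n → Fin n → Bool) → Fin n → Fin n → QGraph (Fin n)
X {n} a i j =
    (((+ 1) / (2 ^ cycleRank a)) {{m^n≢0 2 (cycleRank a)}} , Γ a χ∅)
  ∷ (((- (+ 1)) / (2 ^ cycleRank a)) {{m^n≢0 2 (cycleRank a)}} , Γ a (χ i j))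
  ∷ []

module Submission where

-- A homomorphism S → Γ(S,c) chooses at every vertex x an even assignment, i.e. a row M x of a 0/1
-- matrix supported on the neighbours of x with even weight, subject to M x y = M y x + c(xy) on every
-- edge. Adding up all row parities counts every edge twice, so for c = χ_{e*}, where the right-hand
-- sides add up to 1, there is no homomorphism at all. For c = 0 the homomorphisms are the even
-- subgraphs of S, i.e. the edge sets with zero boundary (degree-parity vector). All 2^|E| edge sets
-- are spread over the boundaries: odd vectors are never boundaries, and since S is connected every
-- even vector is the boundary of a sum of walks, so by translation all 2^(|V|-1) nonempty fibres have
-- the same size. Hence S has 2^(|E|-|V|+1) even subgraphs and hom(S, X(S)) = 1.

open import Defs
open import Algebra.Bundles using (CommutativeRing)
open import Data.Bool using (Bool; true; false; _∧_; _∨_; not; _xor_)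
import Data.Bool as Bool
open import Data.Bool.Properties
  using (xor-∧-commutativeRing; not-involutive; xor-same; xor-comm; xor-assoc; xor-identityʳ;
         ∧-comm; ∧-assoc; ∧-zeroʳ; ∧-identityʳ; ∨-comm; ∨-identityʳ; ∧-distribˡ-xor; ⇔→≡)
open import Data.Empty using (⊥-elim)
open import Data.Fin using (Fin; zero; suc)
open import Data.Fin.Properties using (_≟_; _<?_; <-cmp; <-asym)
import Data.Integer as ℤ
open import Data.List using (List; []; _∷_; [_]; _++_; map; concatMap; filterᵇ; length; allFin; tabulate)
import Data.List as List
open import Data.List.Properties using (map-tabulate; tabulate-lookup)
open import Data.Nat using (ℕ; zero; suc; _+_; _*_; _^_; _∸_; _≤_; s≤s; z≤n; NonZero; ≢-nonZero; ≢-nonZero⁻¹)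
open import Data.Nat.Properties
  using (+-identityʳ; +-assoc; +-comm; *-identityʳ; *-zeroʳ; *-comm; *-assoc; *-distribˡ-+;
         +-commutativeSemigroup; +-*-semiring; ^-distribˡ-+-*; ^-monoʳ-<; *-cancelˡ-≡; m^n≢0;
         m+[n∸m]≡n; m≤m*n; ≮⇒≥; <⇒≱; ≤-trans; ≤-reflexive)
open import Data.Product using (Σ; _×_; _,_; proj₁; proj₂)
open import Data.Product.Function.NonDependent.Propositional using (_×-⇔_)
open import Data.Rational using (ℚ; _/_; 0ℚ; 1ℚ) renaming (_+_ to _+ℚ_; _*_ to _*ℚ_)
import Data.Rational.Properties as ℚ
import Data.Rational.Unnormalised as ℚᵘ
import Data.Rational.Unnormalised.Properties as ℚᵘ
open import Data.Sum using (_⊎_; inj₁; inj₂)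
open import Data.Vec as Vec using (Vec; []; _∷_; lookup)
import Data.Vec.Properties as Vec
open import Function using (_∘_; id; _⇔_; mk⇔; Equivalence)
open import Function.Properties.Equivalence using () renaming (trans to ⇔-trans; sym to ⇔-sym)
open import Relation.Binary.Definitions using (DecidableEquality; tri<; tri≈; tri>)
open import Relation.Binary.PropositionalEquality hiding ([_])
open import Relation.Nullary using (¬_; Dec)
open import Relation.Nullary.Decidable using (⌊_⌋; does; yes; no; dec-true; dec-false; isYes≗does; does-⇔)

open import Algebra.Properties.CommutativeSemigroup +-commutativeSemigroup
  using () renaming (interchange to +-interchange)
open import Algebra.Properties.Semiring.Sum +-*-semiring using (sum-syntax)
import Algebra.Properties.Semiring.Sum (CommutativeRing.semiring xor-∧-commutativeRing) as XorSum

private variable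
  A B : Set
  k m : ℕ

-- Sums over lists

⟦_⟧ : Bool → ℕ
⟦ true  ⟧ = 1
⟦ false ⟧ = 0

⟦∧⟧ : ∀ p q → ⟦ p ∧ q ⟧ ≡ ⟦ p ⟧ * ⟦ q ⟧
⟦∧⟧ true  q = sym (+-identityʳ ⟦ q ⟧)
⟦∧⟧ false q = refl

sumBy : (A → ℕ) → List A → ℕ
sumBy f []       = 0
sumBy f (x ∷ xs) = f x + sumBy f xs

infix 5 sumBy
syntax sumBy (λ x → e) xs = ∑[ x ∈ xs ] e

sumBy-cong : {f g : A → ℕ} (xs : List A) → (∀ x → f x ≡ g x) → sumBy f xs ≡ sumBy g xs
sumBy-cong []       f≗g = refl
sumBy-cong (x ∷ xs) f≗g = cong₂ _+_ (f≗g x) (sumBy-cong xs f≗g)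

sumBy-zero : (xs : List A) → ∑[ x ∈ xs ] 0 ≡ 0
sumBy-zero []       = refl
sumBy-zero (x ∷ xs) = sumBy-zero xs

sumBy-const : (c : ℕ) (xs : List A) → ∑[ x ∈ xs ] c ≡ length xs * c
sumBy-const c []       = refl
sumBy-const c (x ∷ xs) = cong (c +_) (sumBy-const c xs)

sumBy-++ : (f : A → ℕ) (xs ys : List A) → sumBy f (xs ++ ys) ≡ sumBy f xs + sumBy f ys
sumBy-++ f []       ys = refl
sumBy-++ f (x ∷ xs) ys = trans (cong (f x +_) (sumBy-++ f xs ys)) (sym (+-assoc (f x) _ _))

sumBy-map : (f : B → ℕ) (h : A → B) (xs : List A) → sumBy f (map h xs) ≡ sumBy (f ∘ h) xs
sumBy-map f h []       = refl
sumBy-map f h (x ∷ xs) = cong (f (h x) +_) (sumBy-map f h xs)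

sumBy-concatMap : (f : B → ℕ) (h : A → List B) (xs : List A) →
                  sumBy f (concatMap h xs) ≡ ∑[ x ∈ xs ] sumBy f (h x)
sumBy-concatMap f h []       = refl
sumBy-concatMap f h (x ∷ xs) =
  trans (sumBy-++ f (h x) (concatMap h xs)) (cong (sumBy f (h x) +_) (sumBy-concatMap f h xs))

sumBy-distrib-+ : (f g : A → ℕ) (xs : List A) →
                  ∑[ x ∈ xs ] (f x + g x) ≡ sumBy f xs + sumBy g xs
sumBy-distrib-+ f g []       = refl
sumBy-distrib-+ f g (x ∷ xs) =
  trans (cong (f x + g x +_) (sumBy-distrib-+ f g xs)) (+-interchange (f x) (g x) _ _)

*-distribˡ-sumBy : (c : ℕ) (f : A → ℕ) (xs : List A) → c * sumBy f xs ≡ ∑[ x ∈ xs ] c * f x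
*-distribˡ-sumBy c f []       = *-zeroʳ c
*-distribˡ-sumBy c f (x ∷ xs) =
  trans (*-distribˡ-+ c (f x) _) (cong (c * f x +_) (*-distribˡ-sumBy c f xs))

*-distribʳ-sumBy : (c : ℕ) (f : A → ℕ) (xs : List A) → sumBy f xs * c ≡ ∑[ x ∈ xs ] f x * c
*-distribʳ-sumBy c f xs =
  trans (*-comm (sumBy f xs) c) (trans (*-distribˡ-sumBy c f xs) (sumBy-cong xs (λ x → *-comm c (f x))))

sumBy-comm : (f : A → B → ℕ) (xs : List A) (ys : List B) →
             ∑[ x ∈ xs ] ∑[ y ∈ ys ] f x y ≡ ∑[ y ∈ ys ] ∑[ x ∈ xs ] f x y
sumBy-comm f []       ys = sym (sumBy-zero ys)
sumBy-comm f (x ∷ xs) ys =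
  trans (cong (sumBy (f x) ys +_) (sumBy-comm f xs ys)) (sym (sumBy-distrib-+ (f x) _ ys))

sumBy-⟦∧⟧ : (b : Bool) (p : A → Bool) (R : A → ℕ) (xs : List A) →
            ∑[ x ∈ xs ] ⟦ b ∧ p x ⟧ * R x ≡ ⟦ b ⟧ * (∑[ x ∈ xs ] ⟦ p x ⟧ * R x)
sumBy-⟦∧⟧ b p R xs = trans
  (sumBy-cong xs (λ x → trans (cong (_* R x) (⟦∧⟧ b (p x))) (*-assoc ⟦ b ⟧ ⟦ p x ⟧ (R x))))
  (sym (*-distribˡ-sumBy ⟦ b ⟧ _ xs))

length-filterᵇ : (p : A → Bool) (xs : List A) → length (filterᵇ p xs) ≡ ∑[ x ∈ xs ] ⟦ p x ⟧
length-filterᵇ p []       = refl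
length-filterᵇ p (x ∷ xs) with p x
... | true  = cong suc (length-filterᵇ p xs)
... | false = length-filterᵇ p xs

sumBy-filterᵇ : (f : A → ℕ) (p : A → Bool) (xs : List A) →
                sumBy f (filterᵇ p xs) ≡ ∑[ x ∈ xs ] ⟦ p x ⟧ * f x
sumBy-filterᵇ f p []       = refl
sumBy-filterᵇ f p (x ∷ xs) with p x
... | true  = cong₂ _+_ (sym (+-identityʳ (f x))) (sumBy-filterᵇ f p xs)
... | false = sumBy-filterᵇ f p xs

sumBy-tabulate : (f : A → ℕ) (g : Fin k → A) → sumBy f (tabulate g) ≡ ∑[ i < k ] f (g i)
sumBy-tabulate {k = zero}  f g = refl
sumBy-tabulate {k = suc k} f g = cong (f (g zero) +_) (sumBy-tabulate f (g ∘ suc))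

sumBy-allFin : (f : Fin k → ℕ) → sumBy f (allFin k) ≡ ∑[ i < k ] f i
sumBy-allFin f = sumBy-tabulate f id

-- Enumerations and bijections

Enumerates : DecidableEquality A → List A → Set
Enumerates eq? xs = ∀ y → ∑[ x ∈ xs ] ⟦ does (eq? x y) ⟧ ≡ 1

sumBy-select : (eq? : DecidableEquality A) (xs : List A) → Enumerates eq? xs →
               (f : A → ℕ) (y : A) → ∑[ x ∈ xs ] ⟦ does (eq? x y) ⟧ * f x ≡ f y
sumBy-select eq? xs enum f y = begin
  ∑[ x ∈ xs ] ⟦ does (eq? x y) ⟧ * f x   ≡⟨ sumBy-cong xs δ-shift ⟩
  ∑[ x ∈ xs ] ⟦ does (eq? x y) ⟧ * f y   ≡⟨ *-distribʳ-sumBy (f y) _ xs ⟨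
  (∑[ x ∈ xs ] ⟦ does (eq? x y) ⟧) * f y ≡⟨ cong (_* f y) (enum y) ⟩
  1 * f y                                ≡⟨ +-identityʳ (f y) ⟩
  f y                                    ∎
  where
  open ≡-Reasoning
  δ-shift : ∀ x → ⟦ does (eq? x y) ⟧ * f x ≡ ⟦ does (eq? x y) ⟧ * f y
  δ-shift x with eq? x y
  ... | yes refl = refl
  ... | no  _    = refl

sumBy-graph : (eq? : DecidableEquality B) (ys : List B) → Enumerates eq? ys →
              (P : A → Bool) (φ : A → B) (xs : List A) →
              ∑[ x ∈ xs ] ∑[ y ∈ ys ] ⟦ P x ∧ does (eq? y (φ x)) ⟧ ≡ ∑[ x ∈ xs ] ⟦ P x ⟧
sumBy-graph eq? ys enum P φ xs = sumBy-cong xs λ x → begin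
  ∑[ y ∈ ys ] ⟦ P x ∧ does (eq? y (φ x)) ⟧       ≡⟨ sumBy-cong ys (λ y → ⟦∧⟧ (P x) _) ⟩
  ∑[ y ∈ ys ] ⟦ P x ⟧ * ⟦ does (eq? y (φ x)) ⟧   ≡⟨ *-distribˡ-sumBy ⟦ P x ⟧ _ ys ⟨
  ⟦ P x ⟧ * (∑[ y ∈ ys ] ⟦ does (eq? y (φ x)) ⟧) ≡⟨ cong (⟦ P x ⟧ *_) (enum (φ x)) ⟩
  ⟦ P x ⟧ * 1                                    ≡⟨ *-identityʳ ⟦ P x ⟧ ⟩
  ⟦ P x ⟧                                        ∎
  where open ≡-Reasoning

∧-true : ∀ {p q} → (p ∧ q) ≡ true ⇔ (p ≡ true × q ≡ true)
∧-true {true}  = mk⇔ (refl ,_) proj₂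
∧-true {false} = mk⇔ (λ ()) (λ ())

does-true : (d : Dec A) → does d ≡ true ⇔ A
does-true (yes a) = mk⇔ (λ _ → a) (λ _ → refl)
does-true (no ¬a) = mk⇔ (λ ()) (λ a → ⊥-elim (¬a a))

sumBy-bijection : (eqA : DecidableEquality A) (eqB : DecidableEquality B)
                  {xs : List A} {ys : List B} → Enumerates eqA xs → Enumerates eqB ys →
                  (P : A → Bool) (Q : B → Bool) (φ : A → B) (ψ : B → A) →
                  (∀ x → P x ≡ true → Q (φ x) ≡ true × ψ (φ x) ≡ x) →
                  (∀ y → Q y ≡ true → P (ψ y) ≡ true × φ (ψ y) ≡ y) →
                  ∑[ x ∈ xs ] ⟦ P x ⟧ ≡ ∑[ y ∈ ys ] ⟦ Q y ⟧
sumBy-bijection eqA eqB {xs} {ys} enumA enumB P Q φ ψ forward backward = begin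
  ∑[ x ∈ xs ] ⟦ P x ⟧
    ≡⟨ sumBy-graph eqB ys enumB P φ xs ⟨
  ∑[ x ∈ xs ] ∑[ y ∈ ys ] ⟦ P x ∧ does (eqB y (φ x)) ⟧
    ≡⟨ sumBy-cong xs (λ x → sumBy-cong ys (λ y → cong ⟦_⟧ (graph x y))) ⟩
  ∑[ x ∈ xs ] ∑[ y ∈ ys ] ⟦ Q y ∧ does (eqA x (ψ y)) ⟧
    ≡⟨ sumBy-comm _ xs ys ⟩
  ∑[ y ∈ ys ] ∑[ x ∈ xs ] ⟦ Q y ∧ does (eqA x (ψ y)) ⟧
    ≡⟨ sumBy-graph eqA xs enumA Q ψ ys ⟩
  ∑[ y ∈ ys ] ⟦ Q y ⟧
    ∎
  where
  open ≡-Reasoning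
  graph : ∀ x y → (P x ∧ does (eqB y (φ x))) ≡ (Q y ∧ does (eqA x (ψ y)))
  graph x y = ⇔→≡ (mk⇔
    (λ h → let (Px , y≟φx) = Equivalence.to ∧-true h
               y≡φx = Equivalence.to (does-true (eqB y (φ x))) y≟φx
               (Qφx , ψφx≡x) = forward x Px
           in Equivalence.from ∧-true
                (subst (λ z → Q z ≡ true) (sym y≡φx) Qφx ,
                 dec-true (eqA x (ψ y)) (trans (sym ψφx≡x) (cong ψ (sym y≡φx)))))
    (λ h → let (Qy , x≟ψy) = Equivalence.to ∧-true h
               x≡ψy = Equivalence.to (does-true (eqA x (ψ y))) x≟ψy
               (Pψy , φψy≡y) = backward y Qy
           in Equivalence.from ∧-true
                (subst (λ z → P z ≡ true) (sym x≡ψy) Pψy ,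
                 dec-true (eqB y (φ x)) (trans (sym φψy≡y) (cong φ (sym x≡ψy))))))

allFin-enumerates : ∀ k → Enumerates _≟_ (allFin k)
allFin-enumerates zero    ()
allFin-enumerates (suc k) y =
  trans (cong (λ xs → ⟦ does (zero ≟ y) ⟧ + (∑[ x ∈ xs ] ⟦ does (x ≟ y) ⟧)) (sym (map-tabulate id suc)))
        (trans (cong (⟦ does (zero ≟ y) ⟧ +_) (sumBy-map _ suc (allFin k))) (head-or-tail y))
  where
  head-or-tail : ∀ y → ⟦ does (zero ≟ y) ⟧ + (∑[ x ∈ allFin k ] ⟦ does (suc x ≟ y) ⟧) ≡ 1
  head-or-tail zero    = cong suc (sumBy-zero (allFin k))
  head-or-tail (suc y) = allFin-enumerates k y

bools : List Bool
bools = true ∷ false ∷ []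

bools-enumerate : Enumerates Bool._≟_ bools
bools-enumerate true  = refl
bools-enumerate false = refl

vecsOver : List A → (k : ℕ) → List (Vec A k)
vecsOver xs zero    = [ [] ]
vecsOver xs (suc k) = concatMap (λ x → map (x ∷_) (vecsOver xs k)) xs

allVecs≡vecsOver : ∀ m k → allVecs m k ≡ vecsOver (allFin m) k
allVecs≡vecsOver m zero    = refl
allVecs≡vecsOver m (suc k) =
  cong (λ vs → concatMap (λ i → map (i ∷_) vs) (allFin m)) (allVecs≡vecsOver m k)

allBoolVecs≡vecsOver : ∀ k → allBoolVecs k ≡ vecsOver bools k
allBoolVecs≡vecsOver zero    = refl
allBoolVecs≡vecsOver (suc k) =
  cong (λ vs → concatMap (λ b → map (b ∷_) vs) bools) (allBoolVecs≡vecsOver k)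

sumBy-vecsOver-suc : (F : Vec A (suc k) → ℕ) (xs : List A) →
                     sumBy F (vecsOver xs (suc k)) ≡ ∑[ x ∈ xs ] ∑[ v ∈ vecsOver xs k ] F (x ∷ v)
sumBy-vecsOver-suc {k = k} F xs =
  trans (sumBy-concatMap F _ xs) (sumBy-cong xs (λ x → sumBy-map F (x ∷_) (vecsOver xs k)))

sumBy-vecsOver-map : (F : Vec B k → ℕ) (h : A → B) (xs : List A) →
                     ∑[ v ∈ vecsOver xs k ] F (Vec.map h v) ≡ sumBy F (vecsOver (map h xs) k)
sumBy-vecsOver-map {k = zero}  F h xs = refl
sumBy-vecsOver-map {k = suc k} F h xs = begin
  ∑[ v ∈ vecsOver xs (suc k) ] F (Vec.map h v)
    ≡⟨ sumBy-vecsOver-suc _ xs ⟩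
  ∑[ x ∈ xs ] ∑[ v ∈ vecsOver xs k ] F (h x ∷ Vec.map h v)
    ≡⟨ sumBy-cong xs (λ x → sumBy-vecsOver-map (F ∘ (h x ∷_)) h xs) ⟩
  ∑[ x ∈ xs ] ∑[ v ∈ vecsOver (map h xs) k ] F (h x ∷ v)
    ≡⟨ sumBy-map _ h xs ⟨
  ∑[ y ∈ map h xs ] ∑[ v ∈ vecsOver (map h xs) k ] F (y ∷ v)
    ≡⟨ sumBy-vecsOver-suc F (map h xs) ⟨
  sumBy F (vecsOver (map h xs) (suc k))
    ∎
  where open ≡-Reasoning

sumBy-vecsOver-zipWith : (_∙_ : A → B → A) (xs : List A) →
                         (∀ q (G : A → ℕ) → ∑[ x ∈ xs ] G (x ∙ q) ≡ sumBy G xs) →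
                         (w : Vec B k) (F : Vec A k → ℕ) →
                         ∑[ v ∈ vecsOver xs k ] F (Vec.zipWith _∙_ v w) ≡ sumBy F (vecsOver xs k)
sumBy-vecsOver-zipWith _∙_ xs invariant []      F = refl
sumBy-vecsOver-zipWith {k = suc k} _∙_ xs invariant (q ∷ w) F = begin
  ∑[ v ∈ vecsOver xs (suc k) ] F (Vec.zipWith _∙_ v (q ∷ w))
    ≡⟨ sumBy-vecsOver-suc _ xs ⟩
  ∑[ x ∈ xs ] ∑[ v ∈ vecsOver xs k ] F (x ∙ q ∷ Vec.zipWith _∙_ v w)
    ≡⟨ sumBy-cong xs (λ x → sumBy-vecsOver-zipWith _∙_ xs invariant w (F ∘ (x ∙ q ∷_))) ⟩
  ∑[ x ∈ xs ] ∑[ v ∈ vecsOver xs k ] F (x ∙ q ∷ v)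
    ≡⟨ invariant q (λ y → ∑[ v ∈ vecsOver xs k ] F (y ∷ v)) ⟩
  ∑[ x ∈ xs ] ∑[ v ∈ vecsOver xs k ] F (x ∷ v)
    ≡⟨ sumBy-vecsOver-suc F xs ⟨
  sumBy F (vecsOver xs (suc k))
    ∎
  where open ≡-Reasoning

∏ : (Fin k → ℕ) → ℕ
∏ {zero}  f = 1
∏ {suc k} f = f zero * ∏ (f ∘ suc)

∏-cong : {f g : Fin k → ℕ} → (∀ i → f i ≡ g i) → ∏ f ≡ ∏ g
∏-cong {zero}  f≗g = refl
∏-cong {suc k} f≗g = cong₂ _*_ (f≗g zero) (∏-cong (f≗g ∘ suc))

∏-^ : (c : ℕ) (f : Fin k → ℕ) → ∏ (λ i → c ^ f i) ≡ c ^ (∑[ i < k ] f i)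
∏-^ {zero}  c f = refl
∏-^ {suc k} c f = trans (cong (c ^ f zero *_) (∏-^ c (f ∘ suc))) (sym (^-distribˡ-+-* c (f zero) _))

sumBy-vecsOver-∏ : (f : Fin k → A → ℕ) (xs : List A) →
                   ∑[ v ∈ vecsOver xs k ] ∏ (λ i → f i (lookup v i)) ≡ ∏ (λ i → sumBy (f i) xs)
sumBy-vecsOver-∏ {k = zero}  f xs = refl
sumBy-vecsOver-∏ {k = suc k} f xs = begin
  ∑[ v ∈ vecsOver xs (suc k) ] ∏ (λ i → f i (lookup v i))
    ≡⟨ sumBy-vecsOver-suc _ xs ⟩
  ∑[ x ∈ xs ] ∑[ v ∈ vecsOver xs k ] f zero x * ∏ (λ i → f (suc i) (lookup v i))
    ≡⟨ sumBy-cong xs (λ x → *-distribˡ-sumBy (f zero x) _ (vecsOver xs k)) ⟨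
  ∑[ x ∈ xs ] f zero x * (∑[ v ∈ vecsOver xs k ] ∏ (λ i → f (suc i) (lookup v i)))
    ≡⟨ sumBy-cong xs (λ x → cong (f zero x *_) (sumBy-vecsOver-∏ (f ∘ suc) xs)) ⟩
  ∑[ x ∈ xs ] f zero x * ∏ (λ i → sumBy (f (suc i)) xs)
    ≡⟨ *-distribʳ-sumBy _ (f zero) xs ⟨
  sumBy (f zero) xs * ∏ (λ i → sumBy (f (suc i)) xs)
    ∎
  where open ≡-Reasoning

sumBy-vecsOver-1 : (xs : List A) (k : ℕ) → ∑[ v ∈ vecsOver xs k ] 1 ≡ length xs ^ k
sumBy-vecsOver-1 xs zero    = refl
sumBy-vecsOver-1 xs (suc k) = begin
  ∑[ v ∈ vecsOver xs (suc k) ] 1       ≡⟨ sumBy-vecsOver-suc _ xs ⟩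
  ∑[ x ∈ xs ] ∑[ v ∈ vecsOver xs k ] 1 ≡⟨ sumBy-cong xs (λ _ → sumBy-vecsOver-1 xs k) ⟩
  ∑[ x ∈ xs ] length xs ^ k            ≡⟨ sumBy-const _ xs ⟩
  length xs * length xs ^ k            ∎
  where open ≡-Reasoning

vecsOver-enumerates : (eq? : DecidableEquality A) {xs : List A} → Enumerates eq? xs →
                      (k : ℕ) → Enumerates (Vec.≡-dec eq?) (vecsOver xs k)
vecsOver-enumerates eq? enum zero    [] = refl
vecsOver-enumerates eq? {xs} enum (suc k) (y ∷ w) = begin
  ∑[ v ∈ vecsOver xs (suc k) ] ⟦ does (Vec.≡-dec eq? v (y ∷ w)) ⟧
    ≡⟨ sumBy-vecsOver-suc _ xs ⟩
  ∑[ x ∈ xs ] ∑[ v ∈ vecsOver xs k ] ⟦ does (eq? x y) ∧ does (Vec.≡-dec eq? v w) ⟧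
    ≡⟨ sumBy-graph (Vec.≡-dec eq?) (vecsOver xs k) (vecsOver-enumerates eq? enum k) (λ x → does (eq? x y)) (λ _ → w) xs ⟩
  ∑[ x ∈ xs ] ⟦ does (eq? x y) ⟧
    ≡⟨ enum y ⟩
  1
    ∎
  where open ≡-Reasoning

allᶠ : (Fin k → Bool) → Bool
allᶠ {zero}  p = true
allᶠ {suc k} p = p zero ∧ allᶠ (p ∘ suc)

all-tabulate : (p : A → Bool) (f : Fin k → A) → all p (tabulate f) ≡ allᶠ (p ∘ f)
all-tabulate {k = zero}  p f = refl
all-tabulate {k = suc k} p f = cong (p (f zero) ∧_) (all-tabulate p (f ∘ suc))

all-allFin : (p : Fin k → Bool) → all p (allFin k) ≡ allᶠ p
all-allFin p = all-tabulate p id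

allᶠ-cong : {p q : Fin k → Bool} → (∀ i → p i ≡ q i) → allᶠ p ≡ allᶠ q
allᶠ-cong {zero}  p≗q = refl
allᶠ-cong {suc k} p≗q = cong₂ _∧_ (p≗q zero) (allᶠ-cong (p≗q ∘ suc))

all≡allᶠ : {p q : Fin k → Bool} → (∀ i → p i ≡ q i) → all p (allFin k) ≡ allᶠ q
all≡allᶠ {p = p} p≗q = trans (all-allFin p) (allᶠ-cong p≗q)

allᶠ-true : {p : Fin k → Bool} → allᶠ p ≡ true ⇔ (∀ i → p i ≡ true)
allᶠ-true {zero}      = mk⇔ (λ _ ()) (λ _ → refl)
allᶠ-true {suc k} {p} = mk⇔
  (λ h → let (h₀ , hₛ) = Equivalence.to ∧-true h in
         λ { zero → h₀ ; (suc i) → Equivalence.to allᶠ-true hₛ i })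
  (λ h → Equivalence.from ∧-true (h zero , Equivalence.from allᶠ-true (h ∘ suc)))

⟦allᶠ⟧ : (p : Fin k → Bool) → ⟦ allᶠ p ⟧ ≡ ∏ (λ i → ⟦ p i ⟧)
⟦allᶠ⟧ {zero}  p = refl
⟦allᶠ⟧ {suc k} p = trans (⟦∧⟧ (p zero) _) (cong (⟦ p zero ⟧ *_) (⟦allᶠ⟧ (p ∘ suc)))

sumBy-vecsOver-allᶠ : (p : Fin k → A → Bool) (xs : List A) →
                      ∑[ v ∈ vecsOver xs k ] ⟦ allᶠ (λ i → p i (lookup v i)) ⟧ ≡ ∏ (λ i → ∑[ x ∈ xs ] ⟦ p i x ⟧)
sumBy-vecsOver-allᶠ {k} p xs =
  trans (sumBy-cong (vecsOver xs k) (λ v → ⟦allᶠ⟧ (λ i → p i (lookup v i))))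
        (sumBy-vecsOver-∏ (λ i x → ⟦ p i x ⟧) xs)

-- Parity

⨁ : (Fin k → Bool) → Bool
⨁ = XorSum.sum

infix 5 ⨁
syntax ⨁ (λ i → e) = ⨁[ i ] e

⨁-cong : {f g : Fin k → Bool} → (∀ i → f i ≡ g i) → ⨁ f ≡ ⨁ g
⨁-cong = XorSum.sum-cong-≗

⨁-false : ∀ k → ⨁ {k} (λ _ → false) ≡ false
⨁-false k = XorSum.sum-replicate-zero k

δ : Fin k → Fin k → Bool
δ x y = does (x ≟ y)

⨁-select : (v : Fin k) (f : Fin k → Bool) → ⨁[ i ] (δ i v ∧ f i) ≡ f v
⨁-select {suc k} zero    f = trans (cong (f zero xor_) (⨁-false k)) (xor-identityʳ (f zero))
⨁-select {suc k} (suc v) f = ⨁-select v (f ∘ suc)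

δ-sym : (x y : Fin k) → δ x y ≡ δ y x
δ-sym x y = does-⇔ (mk⇔ sym sym) (x ≟ y) (y ≟ x)

⨁-δ : (v : Fin k) → ⨁[ i ] δ i v ≡ true
⨁-δ v = trans (⨁-cong (λ i → sym (∧-identityʳ (δ i v)))) (⨁-select v (λ _ → true))

⨁⨁-select : (f : Fin k → Fin k → Bool) (u v : Fin k) →
            ⨁[ x ] ⨁[ y ] (δ x u ∧ (δ y v ∧ f x y)) ≡ f u v
⨁⨁-select f u v = begin
  ⨁[ x ] ⨁[ y ] (δ x u ∧ (δ y v ∧ f x y))
    ≡⟨ ⨁-cong (λ x → XorSum.*-distribˡ-sum (δ x u) (λ y → δ y v ∧ f x y)) ⟨
  ⨁[ x ] (δ x u ∧ (⨁[ y ] (δ y v ∧ f x y)))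
    ≡⟨ ⨁-cong (λ x → cong (δ x u ∧_) (⨁-select v (f x))) ⟩
  ⨁[ x ] (δ x u ∧ f x v)
    ≡⟨ ⨁-select u (λ x → f x v) ⟩
  f u v
    ∎
  where open ≡-Reasoning

isEven-suc : ∀ m → isEven (suc m) ≡ not (isEven m)
isEven-suc zero          = refl
isEven-suc (suc zero)    = refl
isEven-suc (suc (suc m)) = isEven-suc m

isEven-countTrue : (v : Vec Bool k) → isEven (countTrue v) ≡ not (⨁ (lookup v))
isEven-countTrue []          = refl
isEven-countTrue (true ∷ v)  = trans (isEven-suc (countTrue v)) (cong not (isEven-countTrue v))
isEven-countTrue (false ∷ v) = isEven-countTrue v

lt : Fin k → Fin k → Bool
lt x y = does (x <? y)

-- every off-diagonal entry is counted once, on the side where x < y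
split-by-order : (x y : Fin k) (b : Bool) → (x ≡ y → b ≡ false) →
                 b ≡ (lt x y ∧ b) xor (lt y x ∧ b)
split-by-order x y b diagonal with <-cmp x y
... | tri< x<y _ y≮x rewrite dec-true (x <? y) x<y | dec-false (y <? x) y≮x = sym (xor-identityʳ b)
... | tri> x≮y _ y<x rewrite dec-false (x <? y) x≮y | dec-true (y <? x) y<x = refl
... | tri≈ x≮x refl _ rewrite dec-false (x <? x) x≮x = diagonal refl

lt-asym : {x y : Fin k} → lt x y ≡ true → lt y x ≡ false
lt-asym {x = x} {y} x<y = dec-false (y <? x) (<-asym (Equivalence.to (does-true (x <? y)) x<y))

⨁⨁-xor : (f g : Fin k → Fin k → Bool) →
         ⨁[ x ] ⨁[ y ] (f x y xor g x y) ≡ (⨁[ x ] ⨁[ y ] f x y) xor (⨁[ x ] ⨁[ y ] g x y)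
⨁⨁-xor f g = trans (⨁-cong (λ x → XorSum.∑-distrib-+ (f x) (g x)))
                   (XorSum.∑-distrib-+ (λ x → ⨁[ y ] f x y) (λ x → ⨁[ y ] g x y))

⨁⨁-upper : (M : Fin k → Fin k → Bool) → (∀ x → M x x ≡ false) →
           ⨁[ x ] ⨁[ y ] M x y ≡ ⨁[ x ] ⨁[ y ] (lt x y ∧ (M x y xor M y x))
⨁⨁-upper M diagonal = begin
  ⨁[ x ] ⨁[ y ] M x y
    ≡⟨ ⨁-cong (λ x → ⨁-cong (λ y → split-by-order x y (M x y) (λ { refl → diagonal x }))) ⟩
  ⨁[ x ] ⨁[ y ] ((lt x y ∧ M x y) xor (lt y x ∧ M x y))
    ≡⟨ ⨁⨁-xor (λ x y → lt x y ∧ M x y) (λ x y → lt y x ∧ M x y) ⟩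
  (⨁[ x ] ⨁[ y ] (lt x y ∧ M x y)) xor (⨁[ x ] ⨁[ y ] (lt y x ∧ M x y))
    ≡⟨ cong ((⨁[ x ] ⨁[ y ] (lt x y ∧ M x y)) xor_) (XorSum.∑-comm (λ x y → lt y x ∧ M x y)) ⟩
  (⨁[ x ] ⨁[ y ] (lt x y ∧ M x y)) xor (⨁[ x ] ⨁[ y ] (lt x y ∧ M y x))
    ≡⟨ ⨁⨁-xor (λ x y → lt x y ∧ M x y) (λ x y → lt x y ∧ M y x) ⟨
  ⨁[ x ] ⨁[ y ] ((lt x y ∧ M x y) xor (lt x y ∧ M y x))
    ≡⟨ ⨁-cong (λ x → ⨁-cong (λ y → ∧-distribˡ-xor (lt x y) (M x y) (M y x))) ⟨
  ⨁[ x ] ⨁[ y ] (lt x y ∧ (M x y xor M y x))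
    ∎
  where open ≡-Reasoning

⨁⨁-symmetric : (M : Fin k → Fin k → Bool) → Symmetric M → (∀ x → M x x ≡ false) →
               ⨁[ x ] ⨁[ y ] M x y ≡ false
⨁⨁-symmetric {k} M symmetric diagonal = begin
  ⨁[ x ] ⨁[ y ] M x y                        ≡⟨ ⨁⨁-upper M diagonal ⟩
  ⨁[ x ] ⨁[ y ] (lt x y ∧ (M x y xor M y x)) ≡⟨ ⨁-cong (λ x → trans (⨁-cong (cancel x)) (⨁-false k)) ⟩
  ⨁ {k} (λ _ → false)                        ≡⟨ ⨁-false k ⟩
  false                                      ∎
  where
  open ≡-Reasoning
  cancel : ∀ x y → lt x y ∧ (M x y xor M y x) ≡ false
  cancel x y rewrite symmetric x y | xor-same (M y x) = ∧-zeroʳ (lt x y)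

xor-cancelʳ : ∀ b c → (b xor c) xor b ≡ c
xor-cancelʳ true  c = trans (xor-comm (not c) true) (not-involutive c)
xor-cancelʳ false c = xor-identityʳ c

xor-telescope : ∀ p q r → (p xor q) xor (q xor r) ≡ p xor r
xor-telescope p q r = begin
  (p xor q) xor (q xor r) ≡⟨ xor-assoc p q (q xor r) ⟩
  p xor (q xor (q xor r)) ≡⟨ cong (p xor_) (xor-assoc q q r) ⟨
  p xor ((q xor q) xor r) ≡⟨ cong (λ z → p xor (z xor r)) (xor-same q) ⟩
  p xor r                 ∎
  where open ≡-Reasoning

xor-≡-right : ∀ {p q} → (p xor q) ≡ q ⇔ p ≡ false
xor-≡-right {true}  {true}  = mk⇔ (λ ()) (λ ())
xor-≡-right {true}  {false} = mk⇔ (λ ()) (λ ())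
xor-≡-right {false}         = mk⇔ (λ _ → refl) (λ _ → refl)

count-even-vectors : ∀ m → ∑[ b ∈ vecsOver bools (suc m) ] ⟦ not (⨁ (lookup b)) ⟧ ≡ 2 ^ m
count-even-vectors m = begin
  ∑[ b ∈ vecsOver bools (suc m) ] ⟦ not (⨁ (lookup b)) ⟧
    ≡⟨ sumBy-vecsOver-suc {k = m} (λ b → ⟦ not (⨁ (lookup b)) ⟧) bools ⟩
  ∑[ x ∈ bools ] ∑[ v ∈ vecs ] ⟦ not (x xor ⨁ (lookup v)) ⟧
    ≡⟨ sumBy-comm (λ x v → ⟦ not (x xor ⨁ (lookup v)) ⟧) bools vecs ⟩
  ∑[ v ∈ vecs ] ∑[ x ∈ bools ] ⟦ not (x xor ⨁ (lookup v)) ⟧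
    ≡⟨ sumBy-cong vecs (λ v → one-of-two (⨁ (lookup v))) ⟩
  ∑[ v ∈ vecs ] 1
    ≡⟨ sumBy-vecsOver-1 bools m ⟩
  2 ^ m
    ∎
  where
  open ≡-Reasoning
  vecs = vecsOver bools m
  one-of-two : ∀ e → ∑[ x ∈ bools ] ⟦ not (x xor e) ⟧ ≡ 1
  one-of-two true  = refl
  one-of-two false = refl

false≢true : false ≢ true
false≢true ()

∨-not-true : ∀ {p m} → (p ∨ not m) ≡ true ⇔ (p ≡ false → m ≡ false)
∨-not-true {true}          = mk⇔ (λ _ ()) (λ _ → refl)
∨-not-true {false} {true}  = mk⇔ (λ ()) (λ h → sym (h refl))
∨-not-true {false} {false} = mk⇔ (λ _ _ → refl) (λ _ → refl)

not-xor-true : ∀ {m z} → not (m xor z) ≡ true ⇔ m ≡ z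
not-xor-true {true}  {true}  = mk⇔ (λ _ → refl) (λ _ → refl)
not-xor-true {true}  {false} = mk⇔ (λ ()) (λ ())
not-xor-true {false} {true}  = mk⇔ (λ ()) (λ ())
not-xor-true {false} {false} = mk⇔ (λ _ → refl) (λ _ → refl)

not-∨-∧-true : ∀ {p q} → (not p ∨ (p ∧ q)) ≡ true ⇔ (p ≡ true → q ≡ true)
not-∨-∧-true {true}  = mk⇔ (λ h _ → h) (λ h → h refl)
not-∨-∧-true {false} = mk⇔ (λ _ ()) (λ _ → refl)

∨∧-true : ∀ {p q r s} → ((p ∧ q) ∨ (r ∧ s)) ≡ true → (p ≡ true × q ≡ true) ⊎ (r ≡ true × s ≡ true)
∨∧-true {true}  {true}  _ = inj₁ (refl , refl)
∨∧-true {true}  {false} h = inj₂ (Equivalence.to ∧-true h)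
∨∧-true {false}         h = inj₂ (Equivalence.to ∧-true h)

isEven-countTrue-true : (v : Vec Bool k) → isEven (countTrue v) ≡ true ⇔ ⨁ (lookup v) ≡ false
isEven-countTrue-true v rewrite isEven-countTrue v with ⨁ (lookup v)
... | true  = mk⇔ (λ ()) (λ ())
... | false = mk⇔ (λ _ → refl) (λ _ → refl)

Π-⇔ : {P Q : A → Set} → (∀ x → P x ⇔ Q x) → (∀ x → P x) ⇔ (∀ x → Q x)
Π-⇔ P⇔Q = mk⇔ (λ h x → Equivalence.to (P⇔Q x) (h x)) (λ h x → Equivalence.from (P⇔Q x) (h x))

allᶠ²-true : {p : Fin k → Fin m → Bool} →
             allᶠ (λ x → allᶠ (λ y → p x y)) ≡ true ⇔ (∀ x y → p x y ≡ true)
allᶠ²-true = ⇔-trans allᶠ-true (Π-⇔ (λ _ → allᶠ-true))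

Matrix : ℕ → Set
Matrix k = Vec (Vec Bool k) k

_⟨_,_⟩ : Matrix k → Fin k → Fin k → Bool
M ⟨ x , y ⟩ = lookup (lookup M x) y

matrix : (Fin k → Fin k → Bool) → Matrix k
matrix f = Vec.tabulate (λ x → Vec.tabulate (f x))

matrix-entry : (f : Fin k → Fin k → Bool) (x y : Fin k) → matrix f ⟨ x , y ⟩ ≡ f x y
matrix-entry f x y = trans (cong (λ r → lookup r y) (Vec.lookup∘tabulate _ x)) (Vec.lookup∘tabulate (f x) y)

lookup-ext : {u v : Vec A k} → (∀ i → lookup u i ≡ lookup v i) → u ≡ v
lookup-ext {u = u} {v} u≗v =
  trans (sym (Vec.tabulate∘lookup u)) (trans (Vec.tabulate-cong u≗v) (Vec.tabulate∘lookup v))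

matrix-ext : {M N : Matrix k} → (∀ x y → M ⟨ x , y ⟩ ≡ N ⟨ x , y ⟩) → M ≡ N
matrix-ext M≗N = lookup-ext (λ x → lookup-ext (M≗N x))

_⊕_ : Matrix k → Matrix k → Matrix k
_⊕_ = Vec.zipWith (Vec.zipWith _xor_)

⊕-entry : (M N : Matrix k) (x y : Fin k) → (M ⊕ N) ⟨ x , y ⟩ ≡ M ⟨ x , y ⟩ xor N ⟨ x , y ⟩
⊕-entry M N x y =
  trans (cong (λ r → lookup r y) (Vec.lookup-zipWith (Vec.zipWith _xor_) x M N))
        (Vec.lookup-zipWith _xor_ y (lookup M x) (lookup N x))

⊕-cancelʳ : (M N : Matrix k) (x y : Fin k) → (M ⊕ N) ⟨ x , y ⟩ xor N ⟨ x , y ⟩ ≡ M ⟨ x , y ⟩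
⊕-cancelʳ M N x y = begin
  (M ⊕ N) ⟨ x , y ⟩ xor N ⟨ x , y ⟩             ≡⟨ cong (_xor N ⟨ x , y ⟩) (⊕-entry M N x y) ⟩
  (M ⟨ x , y ⟩ xor N ⟨ x , y ⟩) xor N ⟨ x , y ⟩ ≡⟨ xor-assoc (M ⟨ x , y ⟩) _ _ ⟩
  M ⟨ x , y ⟩ xor (N ⟨ x , y ⟩ xor N ⟨ x , y ⟩) ≡⟨ cong (M ⟨ x , y ⟩ xor_) (xor-same (N ⟨ x , y ⟩)) ⟩
  M ⟨ x , y ⟩ xor false                         ≡⟨ xor-identityʳ _ ⟩
  M ⟨ x , y ⟩                                   ∎
  where open ≡-Reasoning

_≟ᴹ_ : DecidableEquality (Matrix k)
_≟ᴹ_ = Vec.≡-dec (Vec.≡-dec Bool._≟_)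

_≟ᵛ_ : DecidableEquality (Vec Bool k)
_≟ᵛ_ = Vec.≡-dec Bool._≟_

allMatrices : ∀ k → List (Matrix k)
allMatrices k = vecsOver (vecsOver bools k) k

allMatrices-enumerate : ∀ k → Enumerates _≟ᴹ_ (allMatrices k)
allMatrices-enumerate k =
  vecsOver-enumerates _ (vecsOver-enumerates Bool._≟_ bools-enumerate k) k

xor-invariant : ∀ q (G : Bool → ℕ) → ∑[ p ∈ bools ] G (p xor q) ≡ sumBy G bools
xor-invariant true  G = trans (cong (G false +_) (+-identityʳ (G true)))
                              (trans (+-comm (G false) (G true)) (cong (G true +_) (sym (+-identityʳ (G false)))))
xor-invariant false G = refl

sumBy-translate : (M₀ : Matrix k) (F : Matrix k → ℕ) → ∑[ M ∈ allMatrices k ] F (M ⊕ M₀) ≡ sumBy F (allMatrices k)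
sumBy-translate {k} = sumBy-vecsOver-zipWith (Vec.zipWith _xor_) (vecsOver bools k)
                        (sumBy-vecsOver-zipWith _xor_ bools xor-invariant)

-- Edge sets and their boundaries

Adjacency : ℕ → Set
Adjacency k = Fin k → Fin k → Bool

OnEdges : Adjacency k → Adjacency k → Set
OnEdges r f = ∀ x y → r x y ≡ false → f x y ≡ false

-- f is the symmetric 0/1 matrix of a set of edges of the graph r
EdgeSubset : Adjacency k → Adjacency k → Set
EdgeSubset r f = OnEdges r f × Symmetric f

-- the parity of the degree of x in the edge set f
∂ : Adjacency k → Fin k → Bool
∂ f x = ⨁[ y ] f x y

EdgeSubset-xor : {r f g : Adjacency k} → EdgeSubset r f → EdgeSubset r g →
                 EdgeSubset r (λ x y → f x y xor g x y)
EdgeSubset-xor (f-on , f-sym) (g-on , g-sym) =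
  (λ x y r≡false → cong₂ _xor_ (f-on x y r≡false) (g-on x y r≡false)) ,
  (λ x y → cong₂ _xor_ (f-sym x y) (g-sym x y))

EdgeSubset-cong : {r f g : Adjacency k} → (∀ x y → f x y ≡ g x y) → EdgeSubset r f → EdgeSubset r g
EdgeSubset-cong f≗g (onEdges , symmetric) =
  (λ x y rxy → trans (sym (f≗g x y)) (onEdges x y rxy)) ,
  (λ x y → trans (sym (f≗g x y)) (trans (symmetric x y) (f≗g y x)))

∂-xor : (f g : Adjacency k) (x : Fin k) → ∂ (λ u v → f u v xor g u v) x ≡ ∂ f x xor ∂ g x
∂-xor f g x = XorSum.∑-distrib-+ (f x) (g x)

isOnEdges : Adjacency k → Matrix k → Bool
isOnEdges r M = allᶠ (λ x → allᶠ (λ y → r x y ∨ not (M ⟨ x , y ⟩)))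

isOnEdges-true : (r : Adjacency k) (M : Matrix k) → isOnEdges r M ≡ true ⇔ OnEdges r (M ⟨_,_⟩)
isOnEdges-true r M = ⇔-trans allᶠ²-true (Π-⇔ (λ _ → Π-⇔ (λ _ → ∨-not-true)))

isSymmetric : Matrix k → Bool
isSymmetric M = allᶠ (λ x → allᶠ (λ y → not (M ⟨ x , y ⟩ xor M ⟨ y , x ⟩)))

isSymmetric-true : (M : Matrix k) → isSymmetric M ≡ true ⇔ Symmetric (M ⟨_,_⟩)
isSymmetric-true M = ⇔-trans allᶠ²-true (Π-⇔ (λ _ → Π-⇔ (λ _ → not-xor-true)))

isEdgeSubset : Adjacency k → Matrix k → Bool
isEdgeSubset r M = isOnEdges r M ∧ isSymmetric M

isEdgeSubset-true : (r : Adjacency k) (M : Matrix k) → isEdgeSubset r M ≡ true ⇔ EdgeSubset r (M ⟨_,_⟩)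
isEdgeSubset-true r M = ⇔-trans ∧-true (isOnEdges-true r M ×-⇔ isSymmetric-true M)

boundary : Matrix k → Vec Bool k
boundary M = Vec.tabulate (∂ (M ⟨_,_⟩))

≡-boundary : (b : Vec Bool k) (M : Matrix k) → b ≡ boundary M ⇔ (∀ x → ∂ (M ⟨_,_⟩) x ≡ lookup b x)
≡-boundary b M = mk⇔
  (λ b≡∂M x → trans (sym (Vec.lookup∘tabulate _ x)) (cong (λ v → lookup v x) (sym b≡∂M)))
  (λ ∂M≗b → lookup-ext (λ x → trans (sym (∂M≗b x)) (sym (Vec.lookup∘tabulate _ x))))

zeros≡boundary : (M : Matrix k) → Vec.replicate k false ≡ boundary M ⇔ (∀ x → ∂ (M ⟨_,_⟩) x ≡ false)
zeros≡boundary {k} M = ⇔-trans (≡-boundary (Vec.replicate k false) M) (Π-⇔ (λ x →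
  mk⇔ (λ e → trans e (Vec.lookup-replicate x false)) (λ e → trans e (sym (Vec.lookup-replicate x false)))))

count-onEdges : (r : Adjacency k) → ∑[ M ∈ allMatrices k ] ⟦ isOnEdges r M ⟧ ≡ 2 ^ (∑[ x < k ] ∑[ y < k ] ⟦ r x y ⟧)
count-onEdges {k} r = begin
  ∑[ M ∈ allMatrices k ] ⟦ isOnEdges r M ⟧
    ≡⟨ sumBy-vecsOver-allᶠ (λ x row → allᶠ (λ y → r x y ∨ not (lookup row y))) (vecsOver bools k) ⟩
  ∏ (λ x → ∑[ row ∈ vecsOver bools k ] ⟦ allᶠ (λ y → r x y ∨ not (lookup row y)) ⟧)
    ≡⟨ ∏-cong (λ x → sumBy-vecsOver-allᶠ (λ y p → r x y ∨ not p) bools) ⟩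
  ∏ (λ x → ∏ (λ y → ∑[ p ∈ bools ] ⟦ r x y ∨ not p ⟧))
    ≡⟨ ∏-cong (λ x → ∏-cong (λ y → free-bit (r x y))) ⟩
  ∏ (λ x → ∏ (λ y → 2 ^ ⟦ r x y ⟧))
    ≡⟨ ∏-cong (λ x → ∏-^ 2 (λ y → ⟦ r x y ⟧)) ⟩
  ∏ (λ x → 2 ^ (∑[ y < k ] ⟦ r x y ⟧))
    ≡⟨ ∏-^ 2 (λ x → ∑[ y < k ] ⟦ r x y ⟧) ⟩
  2 ^ (∑[ x < k ] ∑[ y < k ] ⟦ r x y ⟧)
    ∎
  where
  open ≡-Reasoning
  free-bit : ∀ e → ∑[ p ∈ bools ] ⟦ e ∨ not p ⟧ ≡ 2 ^ ⟦ e ⟧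
  free-bit true  = refl
  free-bit false = refl

upperPart symmetrise : Matrix k → Matrix k
upperPart M = matrix (λ x y → lt x y ∧ M ⟨ x , y ⟩)
symmetrise U = matrix (λ x y → U ⟨ x , y ⟩ xor U ⟨ y , x ⟩)

χ-does : (i j x y : Fin k) → χ i j x y ≡ (δ x i ∧ δ y j) ∨ (δ x j ∧ δ y i)
χ-does i j x y = cong₂ _∨_ (cong₂ _∧_ (isYes≗does (x ≟ i)) (isYes≗does (y ≟ j)))
                           (cong₂ _∧_ (isYes≗does (x ≟ j)) (isYes≗does (y ≟ i)))

χ-symmetric : (i j : Fin k) → Symmetric (χ i j)
χ-symmetric i j x y = trans (∨-comm (⌊ x ≟ i ⌋ ∧ ⌊ y ≟ j ⌋) _)
                            (cong₂ _∨_ (∧-comm ⌊ x ≟ j ⌋ _) (∧-comm ⌊ x ≟ i ⌋ _))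

χ-true : {i j x y : Fin k} → χ i j x y ≡ true → (x ≡ i × y ≡ j) ⊎ (x ≡ j × y ≡ i)
χ-true {i = i} {j} {x} {y} h with ∨∧-true (trans (sym (χ-does i j x y)) h)
... | inj₁ (x≡i , y≡j) = inj₁ (Equivalence.to (does-true (x ≟ i)) x≡i , Equivalence.to (does-true (y ≟ j)) y≡j)
... | inj₂ (x≡j , y≡i) = inj₂ (Equivalence.to (does-true (x ≟ j)) x≡j , Equivalence.to (does-true (y ≟ i)) y≡i)

χ-edgeSubset : {a : Adjacency k} → Symmetric a → {i j : Fin k} → a i j ≡ true → EdgeSubset a (χ i j)
χ-edgeSubset {a = a} symA {i} {j} aij = onEdges , χ-symmetric i j
  where
  onEdges : OnEdges a (χ i j)
  onEdges x y axy with χ i j x y in eq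
  ... | false = refl
  ... | true with χ-true {i = i} {j} {x} {y} eq
  ...   | inj₁ (refl , refl) = trans (sym aij) axy
  ...   | inj₂ (refl , refl) = trans (sym aij) (trans (symA i j) axy)

module _ {i j : Fin k} (i≢j : i ≢ j) where

  χ≡xor : (x y : Fin k) → χ i j x y ≡ (δ x i ∧ δ y j) xor (δ x j ∧ δ y i)
  χ≡xor x y rewrite χ-does i j x y with x ≟ i | x ≟ j
  ... | yes refl | yes refl = ⊥-elim (i≢j refl)
  ... | yes _    | no _     = trans (∨-identityʳ _) (sym (xor-identityʳ _))
  ... | no _     | _        = refl

  ∂-χ : (x : Fin k) → ∂ (χ i j) x ≡ δ x i xor δ x j
  ∂-χ x = begin
    ⨁[ y ] χ i j x y
      ≡⟨ ⨁-cong (χ≡xor x) ⟩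
    ⨁[ y ] ((δ x i ∧ δ y j) xor (δ x j ∧ δ y i))
      ≡⟨ XorSum.∑-distrib-+ (λ y → δ x i ∧ δ y j) (λ y → δ x j ∧ δ y i) ⟩
    (⨁[ y ] (δ x i ∧ δ y j)) xor (⨁[ y ] (δ x j ∧ δ y i))
      ≡⟨ cong₂ _xor_ (XorSum.*-distribˡ-sum (δ x i) (λ y → δ y j)) (XorSum.*-distribˡ-sum (δ x j) (λ y → δ y i)) ⟨
    (δ x i ∧ (⨁[ y ] δ y j)) xor (δ x j ∧ (⨁[ y ] δ y i))
      ≡⟨ cong₂ _xor_ (cong (δ x i ∧_) (⨁-δ j)) (cong (δ x j ∧_) (⨁-δ i)) ⟩
    (δ x i ∧ true) xor (δ x j ∧ true)
      ≡⟨ cong₂ _xor_ (∧-identityʳ (δ x i)) (∧-identityʳ (δ x j)) ⟩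
    δ x i xor δ x j
      ∎
    where open ≡-Reasoning

  ⨁⨁-upper-χ : ⨁[ x ] ⨁[ y ] (lt x y ∧ χ i j x y) ≡ true
  ⨁⨁-upper-χ = begin
    ⨁[ x ] ⨁[ y ] (lt x y ∧ χ i j x y)
      ≡⟨ ⨁-cong (λ x → ⨁-cong (expand x)) ⟩
    ⨁[ x ] ⨁[ y ] ((δ x i ∧ (δ y j ∧ lt x y)) xor (δ x j ∧ (δ y i ∧ lt x y)))
      ≡⟨ ⨁⨁-xor (λ x y → δ x i ∧ (δ y j ∧ lt x y)) (λ x y → δ x j ∧ (δ y i ∧ lt x y)) ⟩
    (⨁[ x ] ⨁[ y ] (δ x i ∧ (δ y j ∧ lt x y))) xor (⨁[ x ] ⨁[ y ] (δ x j ∧ (δ y i ∧ lt x y)))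
      ≡⟨ cong₂ _xor_ (⨁⨁-select lt i j) (⨁⨁-select lt j i) ⟩
    lt i j xor lt j i
      ≡⟨ cong₂ _xor_ (∧-identityʳ (lt i j)) (∧-identityʳ (lt j i)) ⟨
    (lt i j ∧ true) xor (lt j i ∧ true)
      ≡⟨ split-by-order i j true (λ i≡j → ⊥-elim (i≢j i≡j)) ⟨
    true
      ∎
    where
    open ≡-Reasoning
    rearrange : ∀ l p q → l ∧ (p ∧ q) ≡ p ∧ (q ∧ l)
    rearrange l p q = trans (∧-comm l (p ∧ q)) (∧-assoc p q l)
    expand : ∀ x y → lt x y ∧ χ i j x y ≡ (δ x i ∧ (δ y j ∧ lt x y)) xor (δ x j ∧ (δ y i ∧ lt x y))
    expand x y rewrite χ≡xor x y =
      trans (∧-distribˡ-xor (lt x y) _ _)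
            (cong₂ _xor_ (rearrange (lt x y) (δ x i) (δ y j))
                         (rearrange (lt x y) (δ x j) (δ y i)))

-- Homomorphisms into Γ(S,c)

pairsWith : (P : Fin k → B → Bool) → List B → List (Fin k × B)
pairsWith {k} P L = concatMap (λ w → map (w ,_) (filterᵇ (P w) L)) (allFin k)

sumBy-pairsWith : (P : Fin k → B → Bool) (L : List B) (F : Fin k × B → ℕ) (v : Fin k) →
                  ∑[ p ∈ pairsWith P L ] ⟦ ⌊ proj₁ p ≟ v ⌋ ⟧ * F p ≡ ∑[ e ∈ L ] ⟦ P v e ⟧ * F (v , e)
sumBy-pairsWith {k} P L F v = begin
  ∑[ p ∈ pairsWith P L ] ⟦ ⌊ proj₁ p ≟ v ⌋ ⟧ * F p
    ≡⟨ sumBy-concatMap _ _ (allFin k) ⟩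
  ∑[ w ∈ allFin k ] ∑[ p ∈ map (w ,_) (filterᵇ (P w) L) ] ⟦ ⌊ proj₁ p ≟ v ⌋ ⟧ * F p
    ≡⟨ sumBy-cong (allFin k) (λ w → sumBy-map _ (w ,_) (filterᵇ (P w) L)) ⟩
  ∑[ w ∈ allFin k ] ∑[ e ∈ filterᵇ (P w) L ] ⟦ ⌊ w ≟ v ⌋ ⟧ * F (w , e)
    ≡⟨ sumBy-cong (allFin k) (λ w → *-distribˡ-sumBy ⟦ ⌊ w ≟ v ⌋ ⟧ (λ e → F (w , e)) (filterᵇ (P w) L)) ⟨
  ∑[ w ∈ allFin k ] ⟦ ⌊ w ≟ v ⌋ ⟧ * (∑[ e ∈ filterᵇ (P w) L ] F (w , e))
    ≡⟨ sumBy-cong (allFin k) (λ w → cong (λ b → ⟦ b ⟧ * (∑[ e ∈ filterᵇ (P w) L ] F (w , e))) (isYes≗does (w ≟ v))) ⟩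
  ∑[ w ∈ allFin k ] ⟦ δ w v ⟧ * (∑[ e ∈ filterᵇ (P w) L ] F (w , e))
    ≡⟨ sumBy-select _≟_ (allFin k) (allFin-enumerates k) (λ w → ∑[ e ∈ filterᵇ (P w) L ] F (w , e)) v ⟩
  ∑[ e ∈ filterᵇ (P v) L ] F (v , e)
    ≡⟨ sumBy-filterᵇ _ (P v) L ⟩
  ∑[ e ∈ L ] ⟦ P v e ⟧ * F (v , e)
    ∎
  where open ≡-Reasoning

hasColours : (ι : Fin k → Fin m) → Vec (Fin m × B) k → Bool
hasColours ι g = allᶠ (λ x → ⌊ proj₁ (lookup g x) ≟ ι x ⌋)

admissible : (P : Fin m → B → Bool) (ι : Fin k → Fin m) → Vec B k → Bool
admissible P ι h = allᶠ (λ x → P (ι x) (lookup h x))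

withColours : (ι : Fin k → Fin m) → Vec B k → Vec (Fin m × B) k
withColours ι h = Vec.zip (Vec.tabulate ι) h

-- choosing a vertex of colour ι x for every x is choosing an element of the colour class of ι x
sumBy-vecsOver-pairsWith : (P : Fin m → B → Bool) (L : List B) (ι : Fin k → Fin m) (R : Vec (Fin m × B) k → ℕ) →
                           ∑[ g ∈ vecsOver (pairsWith P L) k ] ⟦ hasColours ι g ⟧ * R g
                           ≡ ∑[ h ∈ vecsOver L k ] ⟦ admissible P ι h ⟧ * R (withColours ι h)
sumBy-vecsOver-pairsWith {k = zero}  P L ι R = refl
sumBy-vecsOver-pairsWith {k = suc k} P L ι R = begin
  ∑[ g ∈ vecsOver V (suc k) ] ⟦ hasColours ι g ⟧ * R g
    ≡⟨ sumBy-vecsOver-suc _ V ⟩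
  ∑[ p ∈ V ] ∑[ g ∈ vecsOver V k ] ⟦ ⌊ proj₁ p ≟ ι zero ⌋ ∧ hasColours (ι ∘ suc) g ⟧ * R (p ∷ g)
    ≡⟨ sumBy-cong V (λ p → sumBy-⟦∧⟧ ⌊ proj₁ p ≟ ι zero ⌋ (hasColours (ι ∘ suc)) (R ∘ (p ∷_)) (vecsOver V k)) ⟩
  ∑[ p ∈ V ] ⟦ ⌊ proj₁ p ≟ ι zero ⌋ ⟧ * (∑[ g ∈ vecsOver V k ] ⟦ hasColours (ι ∘ suc) g ⟧ * R (p ∷ g))
    ≡⟨ sumBy-cong V (λ p → cong (⟦ ⌊ proj₁ p ≟ ι zero ⌋ ⟧ *_) (sumBy-vecsOver-pairsWith P L (ι ∘ suc) (R ∘ (p ∷_)))) ⟩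
  ∑[ p ∈ V ] ⟦ ⌊ proj₁ p ≟ ι zero ⌋ ⟧ * (∑[ h ∈ vecsOver L k ] ⟦ admissible P (ι ∘ suc) h ⟧ * R (p ∷ withColours (ι ∘ suc) h))
    ≡⟨ sumBy-pairsWith P L _ (ι zero) ⟩
  ∑[ e ∈ L ] ⟦ P (ι zero) e ⟧ * (∑[ h ∈ vecsOver L k ] ⟦ admissible P (ι ∘ suc) h ⟧ * R (withColours ι (e ∷ h)))
    ≡⟨ sumBy-cong L (λ e → sumBy-⟦∧⟧ (P (ι zero) e) (admissible P (ι ∘ suc)) _ (vecsOver L k)) ⟨
  ∑[ e ∈ L ] ∑[ h ∈ vecsOver L k ] ⟦ P (ι zero) e ∧ admissible P (ι ∘ suc) h ⟧ * R (withColours ι (e ∷ h))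
    ≡⟨ sumBy-vecsOver-suc _ L ⟨
  ∑[ h ∈ vecsOver L (suc k) ] ⟦ admissible P ι h ⟧ * R (withColours ι h)
    ∎
  where
  open ≡-Reasoning
  V = pairsWith P L

module _ {n : ℕ} (a : Adjacency n) where

  -- Row x of M is the assignment chosen at the vertex of colour x; entries off the neighbourhood of x are
  -- 0 by the encoding of assignments in Γ, and adjacency in Γ(S,c) reads M x y = M y x + c(xy).
  Labelling : (c : Adjacency n) → Matrix n → Set
  Labelling c M = OnEdges a (M ⟨_,_⟩) × (∀ x → ∂ (M ⟨_,_⟩) x ≡ false)
                × (∀ x y → a x y ≡ true → M ⟨ x , y ⟩ ≡ M ⟨ y , x ⟩ xor c x y)

  -- definitionally the predicate selecting evenAssignments a v
  isAssignment : Fin n → Vec Bool n → Bool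
  isAssignment v e = all (λ w → a v w ∨ not (lookup e w)) (allFin n) ∧ isEven (countTrue e)

  ΓAdj : (c : Adjacency n) → Fin n × Vec Bool n → Fin n × Vec Bool n → Bool
  ΓAdj c (u , au) (v , av) = a u v ∧ not (lookup au v xor (lookup av u xor c u v))

  preservesEdges : (c : Adjacency n) → Vec (Fin n × Vec Bool n) n → Bool
  preservesEdges c g = allᶠ (λ x → allᶠ (λ y → not (a x y) ∨ ΓAdj c (lookup g x) (lookup g y)))

  edgesOk : Adjacency n → Matrix n → Bool
  edgesOk c M = allᶠ (λ x → allᶠ (λ y → not (a x y) ∨ ΓAdj c (x , lookup M x) (y , lookup M y)))

  isLabelling : Adjacency n → Matrix n → Bool
  isLabelling c M = admissible isAssignment id M ∧ edgesOk c M

  isAssignment-true : (x : Fin n) (r : Vec Bool n) →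
                      isAssignment x r ≡ true ⇔ ((∀ y → a x y ≡ false → lookup r y ≡ false) × ⨁ (lookup r) ≡ false)
  isAssignment-true x r rewrite all-allFin (λ w → a x w ∨ not (lookup r w)) =
    ⇔-trans ∧-true (⇔-trans allᶠ-true (Π-⇔ (λ _ → ∨-not-true)) ×-⇔ isEven-countTrue-true r)

  isLabelling-true : (c : Adjacency n) (M : Matrix n) → isLabelling c M ≡ true ⇔ Labelling c M
  isLabelling-true c M = ⇔-trans ∧-true (⇔-trans (rows ×-⇔ edgeConditions) regroup)
    where
    rows = ⇔-trans allᶠ-true (Π-⇔ (λ x → isAssignment-true x (lookup M x)))
    edgeConditions = ⇔-trans allᶠ²-true (Π-⇔ (λ x → Π-⇔ (λ y → ⇔-trans not-∨-∧-true (Π-⇔ (λ _ → not-xor-true)))))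
    regroup = mk⇔ (λ (h , e) → (λ x → proj₁ (h x)) , (λ x → proj₂ (h x)) , e)
                  (λ (o , d , e) → (λ x → o x , d x) , e)

  isHom-Γ : (c : Adjacency n) (f : Vec (Fin (length (ΓVerts a))) n) →
            let g = Vec.map (List.lookup (ΓVerts a)) f in
            isHom _≟_ (colorful a) (Γ a c) f ≡ hasColours id g ∧ preservesEdges c g
  isHom-Γ c f = cong₂ _∧_
    (all≡allᶠ (λ x → cong (λ p → ⌊ proj₁ p ≟ x ⌋) (looked x)))
    (all≡allᶠ (λ x → all≡allᶠ (λ y → cong₂ (λ p q → not (a x y) ∨ ΓAdj c p q) (looked x) (looked y))))
    where
    vertex = List.lookup (ΓVerts a)
    looked : ∀ x → vertex (lookup f x) ≡ lookup (Vec.map vertex f) x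
    looked x = sym (Vec.lookup-map x vertex f)

  preservesEdges-diagonal : (c : Adjacency n) (M : Matrix n) → preservesEdges c (withColours id M) ≡ edgesOk c M
  preservesEdges-diagonal c M = allᶠ-cong (λ x → allᶠ-cong (λ y →
    cong₂ (λ p q → not (a x y) ∨ ΓAdj c p q) (diagonal x) (diagonal y)))
    where
    diagonal : ∀ x → lookup (withColours id M) x ≡ (x , lookup M x)
    diagonal x = trans (Vec.lookup-zip x (Vec.tabulate id) M) (cong (_, lookup M x) (Vec.lookup∘tabulate id x))

  hom-Γ : (c : Adjacency n) → hom _≟_ (colorful a) (Γ a c) ≡ ∑[ M ∈ allMatrices n ] ⟦ isLabelling c M ⟧
  hom-Γ c = begin
    length (filterᵇ (isHom _≟_ (colorful a) (Γ a c)) (allVecs N n))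
      ≡⟨ length-filterᵇ _ (allVecs N n) ⟩
    ∑[ f ∈ allVecs N n ] ⟦ isHom _≟_ (colorful a) (Γ a c) f ⟧
      ≡⟨ cong (sumBy _) (allVecs≡vecsOver N n) ⟩
    ∑[ f ∈ vecsOver (allFin N) n ] ⟦ isHom _≟_ (colorful a) (Γ a c) f ⟧
      ≡⟨ sumBy-cong (vecsOver (allFin N) n) (λ f → trans (cong ⟦_⟧ (isHom-Γ c f))
                                                         (⟦∧⟧ (hasColours id (Vec.map vertex f)) (preservesEdges c (Vec.map vertex f)))) ⟩
    ∑[ f ∈ vecsOver (allFin N) n ] W (Vec.map vertex f)
      ≡⟨ sumBy-vecsOver-map W vertex (allFin N) ⟩
    sumBy W (vecsOver (map vertex (allFin N)) n)
      ≡⟨ cong (λ vs → sumBy W (vecsOver vs n)) (trans (map-tabulate id vertex) (tabulate-lookup V)) ⟩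
    sumBy W (vecsOver V n)
      ≡⟨ sumBy-vecsOver-pairsWith isAssignment (allBoolVecs n) id (λ g → ⟦ preservesEdges c g ⟧) ⟩
    ∑[ M ∈ vecsOver (allBoolVecs n) n ] ⟦ admissible isAssignment id M ⟧ * ⟦ preservesEdges c (withColours id M) ⟧
      ≡⟨ cong (λ rows → ∑[ M ∈ vecsOver rows n ] ⟦ admissible isAssignment id M ⟧ * ⟦ preservesEdges c (withColours id M) ⟧)
              (allBoolVecs≡vecsOver n) ⟩
    ∑[ M ∈ allMatrices n ] ⟦ admissible isAssignment id M ⟧ * ⟦ preservesEdges c (withColours id M) ⟧
      ≡⟨ sumBy-cong (allMatrices n) (λ M → cong (λ e → ⟦ admissible isAssignment id M ⟧ * ⟦ e ⟧) (preservesEdges-diagonal c M)) ⟩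
    ∑[ M ∈ allMatrices n ] ⟦ admissible isAssignment id M ⟧ * ⟦ edgesOk c M ⟧
      ≡⟨ sumBy-cong (allMatrices n) (λ M → ⟦∧⟧ (admissible isAssignment id M) (edgesOk c M)) ⟨
    ∑[ M ∈ allMatrices n ] ⟦ isLabelling c M ⟧
      ∎
    where
    open ≡-Reasoning
    V = ΓVerts a
    N = length V
    vertex = List.lookup V
    W : Vec (Fin n × Vec Bool n) n → ℕ
    W g = ⟦ hasColours id g ⟧ * ⟦ preservesEdges c g ⟧


module _ {n : ℕ} {a : Adjacency n} (symA : Symmetric a) (irrA : Irreflexive a) where

  labelling-χ-impossible : {i j : Fin n} → a i j ≡ true → (M : Matrix n) → ¬ Labelling a (χ i j) M
  labelling-χ-impossible {i} {j} aij M (onEdges , even , edge) = false≢true (begin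
    false
      ≡⟨ ⨁-false n ⟨
    ⨁ {n} (λ _ → false)
      ≡⟨ ⨁-cong even ⟨
    ⨁[ x ] ∂ (M ⟨_,_⟩) x
      ≡⟨ ⨁⨁-upper (M ⟨_,_⟩) (λ x → onEdges x x (irrA x)) ⟩
    ⨁[ x ] ⨁[ y ] (lt x y ∧ (M ⟨ x , y ⟩ xor M ⟨ y , x ⟩))
      ≡⟨ ⨁-cong (λ x → ⨁-cong (λ y → cong (lt x y ∧_) (antisymmetric x y))) ⟩
    ⨁[ x ] ⨁[ y ] (lt x y ∧ χ i j x y)
      ≡⟨ ⨁⨁-upper-χ i≢j ⟩
    true
      ∎)
    where
    open ≡-Reasoning
    i≢j : i ≢ j
    i≢j refl = false≢true (trans (sym (irrA i)) aij)
    antisymmetric : ∀ x y → M ⟨ x , y ⟩ xor M ⟨ y , x ⟩ ≡ χ i j x y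
    antisymmetric x y with a x y in axy
    ... | true  = trans (cong (_xor M ⟨ y , x ⟩) (edge x y axy)) (xor-cancelʳ (M ⟨ y , x ⟩) _)
    ... | false = trans (cong₂ _xor_ (onEdges x y axy) (onEdges y x (trans (symA y x) axy)))
                        (sym (proj₁ (χ-edgeSubset symA aij) x y axy))

  labelling-χ∅ : (M : Matrix n) → Labelling a χ∅ M ⇔ (EdgeSubset a (M ⟨_,_⟩) × (∀ x → ∂ (M ⟨_,_⟩) x ≡ false))
  labelling-χ∅ M = mk⇔
    (λ (onEdges , even , edge) → (onEdges , symmetric onEdges edge) , even)
    (λ ((onEdges , symmetric) , even) →
       onEdges , even , λ x y _ → trans (symmetric x y) (sym (xor-identityʳ _)))
    where
    symmetric : OnEdges a (M ⟨_,_⟩) → (∀ x y → a x y ≡ true → M ⟨ x , y ⟩ ≡ M ⟨ y , x ⟩ xor false) →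
                Symmetric (M ⟨_,_⟩)
    symmetric onEdges edge x y with a x y in axy
    ... | true  = trans (edge x y axy) (xor-identityʳ _)
    ... | false = trans (onEdges x y axy) (sym (onEdges y x (trans (symA y x) axy)))

  isLabelling-χ∅ : (M : Matrix n) →
                   isLabelling a χ∅ M ≡ isEdgeSubset a M ∧ does (Vec.replicate n false ≟ᵛ boundary M)
  isLabelling-χ∅ M = ⇔→≡ (⇔-trans (isLabelling-true a χ∅ M) (⇔-trans (labelling-χ∅ M) (⇔-sym
    (⇔-trans ∧-true (isEdgeSubset-true a M ×-⇔ ⇔-trans (does-true (Vec.replicate n false ≟ᵛ boundary M))
                                                       (zeros≡boundary M))))))

  length-edges : length (edges a) ≡ ∑[ x < n ] ∑[ y < n ] ⟦ lt x y ∧ a x y ⟧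
  length-edges = begin
    length (edges a)
      ≡⟨ length-filterᵇ _ (concatMap (λ u → map (u ,_) (allFin n)) (allFin n)) ⟩
    ∑[ p ∈ concatMap (λ u → map (u ,_) (allFin n)) (allFin n) ] ⟦ lt (proj₁ p) (proj₂ p) ∧ a (proj₁ p) (proj₂ p) ⟧
      ≡⟨ sumBy-concatMap _ (λ u → map (u ,_) (allFin n)) (allFin n) ⟩
    ∑[ x ∈ allFin n ] ∑[ p ∈ map (x ,_) (allFin n) ] ⟦ lt (proj₁ p) (proj₂ p) ∧ a (proj₁ p) (proj₂ p) ⟧
      ≡⟨ sumBy-cong (allFin n) (λ x → trans (sumBy-map _ (x ,_) (allFin n)) (sumBy-allFin (λ y → ⟦ lt x y ∧ a x y ⟧))) ⟩
    ∑[ x ∈ allFin n ] ∑[ y < n ] ⟦ lt x y ∧ a x y ⟧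
      ≡⟨ sumBy-allFin (λ x → ∑[ y < n ] ⟦ lt x y ∧ a x y ⟧) ⟩
    ∑[ x < n ] ∑[ y < n ] ⟦ lt x y ∧ a x y ⟧
      ∎
    where open ≡-Reasoning

  upper : Adjacency n
  upper x y = lt x y ∧ a x y

  upperPart-edgeSubset : (M : Matrix n) → isEdgeSubset a M ≡ true →
                         isOnEdges upper (upperPart M) ≡ true × symmetrise (upperPart M) ≡ M
  upperPart-edgeSubset M M-edges = Equivalence.from (isOnEdges-true upper (upperPart M)) onUpper , matrix-ext entries
    where
    edgeSubset = Equivalence.to (isEdgeSubset-true a M) M-edges
    onUpper : OnEdges upper (upperPart M ⟨_,_⟩)
    onUpper x y upper≡false rewrite matrix-entry (λ x y → lt x y ∧ M ⟨ x , y ⟩) x y with lt x y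
    ... | false = refl
    ... | true  = proj₁ edgeSubset x y upper≡false
    entries : ∀ x y → symmetrise (upperPart M) ⟨ x , y ⟩ ≡ M ⟨ x , y ⟩
    entries x y rewrite matrix-entry (λ x y → upperPart M ⟨ x , y ⟩ xor upperPart M ⟨ y , x ⟩) x y
                      | matrix-entry (λ x y → lt x y ∧ M ⟨ x , y ⟩) x y
                      | matrix-entry (λ x y → lt x y ∧ M ⟨ x , y ⟩) y x
                      | proj₂ edgeSubset y x
      = sym (split-by-order x y (M ⟨ x , y ⟩) (λ { refl → proj₁ edgeSubset x x (irrA x) }))

  symmetrise-upper : (U : Matrix n) → isOnEdges upper U ≡ true →
                     isEdgeSubset a (symmetrise U) ≡ true × upperPart (symmetrise U) ≡ U
  symmetrise-upper U U-upper = Equivalence.from (isEdgeSubset-true a (symmetrise U)) (onEdges , symmetric) , matrix-ext entries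
    where
    onUpper = Equivalence.to (isOnEdges-true upper U) U-upper
    onEdges : OnEdges a (symmetrise U ⟨_,_⟩)
    onEdges x y axy rewrite matrix-entry (λ x y → U ⟨ x , y ⟩ xor U ⟨ y , x ⟩) x y =
      cong₂ _xor_ (onUpper x y (trans (cong (lt x y ∧_) axy) (∧-zeroʳ (lt x y))))
                  (onUpper y x (trans (cong (lt y x ∧_) (trans (symA y x) axy)) (∧-zeroʳ (lt y x))))
    symmetric : Symmetric (symmetrise U ⟨_,_⟩)
    symmetric x y rewrite matrix-entry (λ x y → U ⟨ x , y ⟩ xor U ⟨ y , x ⟩) x y
                        | matrix-entry (λ x y → U ⟨ x , y ⟩ xor U ⟨ y , x ⟩) y x = xor-comm (U ⟨ x , y ⟩) (U ⟨ y , x ⟩)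
    entries : ∀ x y → upperPart (symmetrise U) ⟨ x , y ⟩ ≡ U ⟨ x , y ⟩
    entries x y rewrite matrix-entry (λ x y → lt x y ∧ symmetrise U ⟨ x , y ⟩) x y
                      | matrix-entry (λ x y → U ⟨ x , y ⟩ xor U ⟨ y , x ⟩) x y
      with lt x y in x<y
    ... | true  = trans (cong (U ⟨ x , y ⟩ xor_) (onUpper y x (cong (_∧ a y x) (lt-asym {x = x} {y} x<y))))
                        (xor-identityʳ (U ⟨ x , y ⟩))
    ... | false = sym (onUpper x y (cong (_∧ a x y) x<y))

  count-edgeSubsets : ∑[ M ∈ allMatrices n ] ⟦ isEdgeSubset a M ⟧ ≡ 2 ^ length (edges a)
  count-edgeSubsets = begin
    ∑[ M ∈ allMatrices n ] ⟦ isEdgeSubset a M ⟧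
      ≡⟨ sumBy-bijection _≟ᴹ_ _≟ᴹ_ {allMatrices n} {allMatrices n} (allMatrices-enumerate n) (allMatrices-enumerate n)
                         (isEdgeSubset a) (isOnEdges upper) upperPart symmetrise upperPart-edgeSubset symmetrise-upper ⟩
    ∑[ U ∈ allMatrices n ] ⟦ isOnEdges upper U ⟧
      ≡⟨ count-onEdges upper ⟩
    2 ^ (∑[ x < n ] ∑[ y < n ] ⟦ lt x y ∧ a x y ⟧)
      ≡⟨ cong (2 ^_) length-edges ⟨
    2 ^ length (edges a)
      ∎
    where open ≡-Reasoning

  handshake : {f : Adjacency n} → EdgeSubset a f → ⨁[ x ] ∂ f x ≡ false
  handshake {f} (onEdges , symmetric) = ⨁⨁-symmetric f symmetric (λ x → onEdges x x (irrA x))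

  -- the edges that the walk uses an odd number of times
  walk : {u v : Fin n} → Reach a u v → Adjacency n
  walk here               = λ _ _ → false
  walk (step {u} {w} _ r) = λ x y → χ u w x y xor walk r x y

  walk-edgeSubset : {u v : Fin n} (r : Reach a u v) → EdgeSubset a (walk r)
  walk-edgeSubset here       = (λ _ _ _ → refl) , (λ _ _ → refl)
  walk-edgeSubset (step e r) = EdgeSubset-xor (χ-edgeSubset symA e) (walk-edgeSubset r)

  ∂-walk : {u v : Fin n} (r : Reach a u v) (x : Fin n) → ∂ (walk r) x ≡ δ x u xor δ x v
  ∂-walk {u} here x = trans (⨁-false n) (sym (xor-same (δ x u)))
  ∂-walk (step {u} {w} {v} e r) x = begin
    ∂ (λ x y → χ u w x y xor walk r x y) x  ≡⟨ ∂-xor (χ u w) (walk r) x ⟩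
    ∂ (χ u w) x xor ∂ (walk r) x            ≡⟨ cong₂ _xor_ (∂-χ u≢w x) (∂-walk r x) ⟩
    (δ x u xor δ x w) xor (δ x w xor δ x v) ≡⟨ xor-telescope (δ x u) (δ x w) (δ x v) ⟩
    δ x u xor δ x v                         ∎
    where
    open ≡-Reasoning
    u≢w : u ≢ w
    u≢w refl = false≢true (trans (sym (irrA u)) e)

  walksTo : Connected a → Fin n → Vec Bool n → Adjacency n
  walksTo connected root b x y = ⨁[ v ] (lookup b v ∧ walk (connected root v) x y)

  walksTo-edgeSubset : (connected : Connected a) (root : Fin n) (b : Vec Bool n) →
                       EdgeSubset a (walksTo connected root b)
  walksTo-edgeSubset connected root b =
    (λ x y axy → trans (⨁-cong (λ v → trans (cong (lookup b v ∧_) (proj₁ (walk-edgeSubset (connected root v)) x y axy))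
                                             (∧-zeroʳ (lookup b v))))
                       (⨁-false n)) ,
    (λ x y → ⨁-cong (λ v → cong (lookup b v ∧_) (proj₂ (walk-edgeSubset (connected root v)) x y)))

  ∂-walksTo : (connected : Connected a) (root : Fin n) (b : Vec Bool n) → ⨁ (lookup b) ≡ false →
              (x : Fin n) → ∂ (walksTo connected root b) x ≡ lookup b x
  ∂-walksTo connected root b even x = begin
    ⨁[ y ] ⨁[ v ] (lookup b v ∧ W v x y)
      ≡⟨ XorSum.∑-comm (λ y v → lookup b v ∧ W v x y) ⟩
    ⨁[ v ] ⨁[ y ] (lookup b v ∧ W v x y)
      ≡⟨ ⨁-cong (λ v → XorSum.*-distribˡ-sum (lookup b v) (W v x)) ⟨
    ⨁[ v ] (lookup b v ∧ ∂ (W v) x)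
      ≡⟨ ⨁-cong (λ v → cong (lookup b v ∧_) (∂-walk (connected root v) x)) ⟩
    ⨁[ v ] (lookup b v ∧ (δ x root xor δ x v))
      ≡⟨ ⨁-cong (λ v → ∧-distribˡ-xor (lookup b v) (δ x root) (δ x v)) ⟩
    ⨁[ v ] ((lookup b v ∧ δ x root) xor (lookup b v ∧ δ x v))
      ≡⟨ XorSum.∑-distrib-+ (λ v → lookup b v ∧ δ x root) (λ v → lookup b v ∧ δ x v) ⟩
    (⨁[ v ] (lookup b v ∧ δ x root)) xor (⨁[ v ] (lookup b v ∧ δ x v))
      ≡⟨ cong₂ _xor_ (XorSum.*-distribʳ-sum (δ x root) (lookup b))
                     (⨁-cong (λ v → trans (cong (_∧ lookup b v) (δ-sym v x)) (∧-comm (δ x v) (lookup b v)))) ⟨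
    ((⨁ (lookup b)) ∧ δ x root) xor (⨁[ v ] (δ v x ∧ lookup b v))
      ≡⟨ cong₂ _xor_ (cong (_∧ δ x root) even) (⨁-select x (lookup b)) ⟩
    lookup b x
      ∎
    where
    open ≡-Reasoning
    W : Fin n → Adjacency n
    W v = walk (connected root v)

  boundary-surjective : Connected a → Fin n → (b : Vec Bool n) → ⨁ (lookup b) ≡ false →
                        Σ (Matrix n) (λ M → EdgeSubset a (M ⟨_,_⟩) × b ≡ boundary M)
  boundary-surjective connected root b even =
    matrix f ,
    EdgeSubset-cong (λ x y → sym (matrix-entry f x y)) (walksTo-edgeSubset connected root b) ,
    Equivalence.from (≡-boundary b (matrix f))
      (λ x → trans (⨁-cong (matrix-entry f x)) (∂-walksTo connected root b even x))
    where
    f = walksTo connected root b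

  fibre : Vec Bool n → ℕ
  fibre b = ∑[ M ∈ allMatrices n ] ⟦ isEdgeSubset a M ∧ does (b ≟ᵛ boundary M) ⟧

  fibre-odd : (b : Vec Bool n) → ⨁ (lookup b) ≡ true → fibre b ≡ 0
  fibre-odd b odd = trans (sumBy-cong (allMatrices n) (cong ⟦_⟧ ∘ empty)) (sumBy-zero (allMatrices n))
    where
    empty : ∀ M → isEdgeSubset a M ∧ does (b ≟ᵛ boundary M) ≡ false
    empty M with isEdgeSubset a M in M-edges
    ... | false = refl
    ... | true  = dec-false (b ≟ᵛ boundary M) λ b≡∂M → false≢true (begin
      false                ≡⟨ handshake (Equivalence.to (isEdgeSubset-true a M) M-edges) ⟨
      ⨁[ x ] ∂ (M ⟨_,_⟩) x ≡⟨ ⨁-cong (Equivalence.to (≡-boundary b M) b≡∂M) ⟩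
      ⨁ (lookup b)         ≡⟨ odd ⟩
      true                 ∎)
      where open ≡-Reasoning

  isEdgeSubset-⊕ : {N : Matrix n} → EdgeSubset a (N ⟨_,_⟩) → (M : Matrix n) → isEdgeSubset a (M ⊕ N) ≡ isEdgeSubset a M
  isEdgeSubset-⊕ {N} N-edges M = ⇔→≡ (⇔-trans (isEdgeSubset-true a (M ⊕ N)) (⇔-trans (mk⇔
    (λ M⊕N-edges → EdgeSubset-cong (⊕-cancelʳ M N) (EdgeSubset-xor M⊕N-edges N-edges))
    (λ M-edges → EdgeSubset-cong (λ x y → sym (⊕-entry M N x y)) (EdgeSubset-xor M-edges N-edges)))
    (⇔-sym (isEdgeSubset-true a M))))

  boundary-⊕ : {N : Matrix n} {b : Vec Bool n} → b ≡ boundary N → (M : Matrix n) →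
               b ≡ boundary (M ⊕ N) ⇔ Vec.replicate n false ≡ boundary M
  boundary-⊕ {N} {b} b≡∂N M = ⇔-trans (≡-boundary b (M ⊕ N))
    (⇔-trans (Π-⇔ (λ x → ⇔-trans (mk⇔ (trans (sym (∂⊕ x))) (trans (∂⊕ x))) xor-≡-right))
             (⇔-sym (zeros≡boundary M)))
    where
    ∂⊕ : ∀ x → ∂ ((M ⊕ N) ⟨_,_⟩) x ≡ ∂ (M ⟨_,_⟩) x xor lookup b x
    ∂⊕ x = trans (⨁-cong (⊕-entry M N x))
                 (trans (∂-xor (M ⟨_,_⟩) (N ⟨_,_⟩) x)
                        (cong (∂ (M ⟨_,_⟩) x xor_) (Equivalence.to (≡-boundary b N) b≡∂N x)))

  fibre-even : Connected a → Fin n → (b : Vec Bool n) → ⨁ (lookup b) ≡ false →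
               fibre b ≡ fibre (Vec.replicate n false)
  fibre-even connected root b even with boundary-surjective connected root b even
  ... | M₀ , M₀-edges , b≡∂M₀ = begin
    fibre b
      ≡⟨ sumBy-translate M₀ (λ M → ⟦ isEdgeSubset a M ∧ does (b ≟ᵛ boundary M) ⟧) ⟨
    ∑[ M ∈ allMatrices n ] ⟦ isEdgeSubset a (M ⊕ M₀) ∧ does (b ≟ᵛ boundary (M ⊕ M₀)) ⟧
      ≡⟨ sumBy-cong (allMatrices n) (λ M → cong ⟦_⟧ (cong₂ _∧_ (isEdgeSubset-⊕ M₀-edges M)
           (does-⇔ (boundary-⊕ b≡∂M₀ M) (b ≟ᵛ boundary (M ⊕ M₀)) (Vec.replicate n false ≟ᵛ boundary M)))) ⟩
    fibre (Vec.replicate n false)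
      ∎
    where open ≡-Reasoning

  fibre-sum : ∑[ b ∈ vecsOver bools n ] fibre b ≡ ∑[ M ∈ allMatrices n ] ⟦ isEdgeSubset a M ⟧
  fibre-sum = trans (sumBy-comm (λ b M → ⟦ isEdgeSubset a M ∧ does (b ≟ᵛ boundary M) ⟧) (vecsOver bools n) (allMatrices n))
                    (sumBy-graph _≟ᵛ_ (vecsOver bools n) (vecsOver-enumerates Bool._≟_ bools-enumerate n)
                                 (isEdgeSubset a) boundary (allMatrices n))

  hom-Γ-χ : {i j : Fin n} → a i j ≡ true → hom _≟_ (colorful a) (Γ a (χ i j)) ≡ 0
  hom-Γ-χ {i} {j} aij =
    trans (hom-Γ a (χ i j)) (trans (sumBy-cong (allMatrices n) (cong ⟦_⟧ ∘ no-labelling)) (sumBy-zero (allMatrices n)))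
    where
    no-labelling : ∀ M → isLabelling a (χ i j) M ≡ false
    no-labelling M with isLabelling a (χ i j) M in labelling
    ... | false = refl
    ... | true  = ⊥-elim (labelling-χ-impossible aij M (Equivalence.to (isLabelling-true a (χ i j) M) labelling))

2^-factor : ∀ e m F → 2 ^ e ≡ 2 ^ m * F → F ≡ 2 ^ (e ∸ m)
2^-factor e m F 2^e≡ = *-cancelˡ-≡ F (2 ^ (e ∸ m)) (2 ^ m) {{m^n≢0 2 m}} (begin
  2 ^ m * F           ≡⟨ 2^e≡ ⟨
  2 ^ e               ≡⟨ cong (2 ^_) (m+[n∸m]≡n m≤e) ⟨
  2 ^ (m + (e ∸ m))   ≡⟨ ^-distribˡ-+-* 2 m (e ∸ m) ⟩
  2 ^ m * 2 ^ (e ∸ m) ∎)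
  where
  open ≡-Reasoning
  F≢0 : F ≢ 0
  F≢0 refl = ≢-nonZero⁻¹ (2 ^ e) {{m^n≢0 2 e}} (trans 2^e≡ (*-zeroʳ (2 ^ m)))
  m≤e : m ≤ e
  m≤e = ≮⇒≥ λ e<m → <⇒≱ (^-monoʳ-< 2 (s≤s (s≤s z≤n)) e<m)
                         (≤-trans (m≤m*n (2 ^ m) F {{≢-nonZero F≢0}}) (≤-reflexive (sym 2^e≡)))

2^edges≡2^m*fibre₀ : {m : ℕ} {a : Adjacency (suc m)} (symA : Symmetric a) (irrA : Irreflexive a) → Connected a →
                      2 ^ length (edges a) ≡ 2 ^ m * fibre symA irrA (Vec.replicate (suc m) false)
2^edges≡2^m*fibre₀ {m} {a} symA irrA connected = begin
  2 ^ length (edges a)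
    ≡⟨ count-edgeSubsets symA irrA ⟨
  ∑[ M ∈ allMatrices (suc m) ] ⟦ isEdgeSubset a M ⟧
    ≡⟨ fibre-sum symA irrA ⟨
  ∑[ b ∈ vecsOver bools (suc m) ] fibre symA irrA b
    ≡⟨ sumBy-cong (vecsOver bools (suc m)) even-or-odd ⟩
  ∑[ b ∈ vecsOver bools (suc m) ] ⟦ not (⨁ (lookup b)) ⟧ * fibre₀
    ≡⟨ *-distribʳ-sumBy fibre₀ _ (vecsOver bools (suc m)) ⟨
  (∑[ b ∈ vecsOver bools (suc m) ] ⟦ not (⨁ (lookup b)) ⟧) * fibre₀
    ≡⟨ cong (_* fibre₀) (count-even-vectors m) ⟩
  2 ^ m * fibre₀
    ∎
  where
  open ≡-Reasoning
  fibre₀ = fibre symA irrA (Vec.replicate (suc m) false)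
  even-or-odd : ∀ b → fibre symA irrA b ≡ ⟦ not (⨁ (lookup b)) ⟧ * fibre₀
  even-or-odd b with ⨁ (lookup b) in parity
  ... | true  = fibre-odd symA irrA b parity
  ... | false = trans (fibre-even symA irrA connected zero b parity) (sym (+-identityʳ fibre₀))

hom-Γ-χ∅ : {m : ℕ} {a : Adjacency (suc m)} → Symmetric a → Irreflexive a → Connected a →
           hom _≟_ (colorful a) (Γ a χ∅) ≡ 2 ^ cycleRank a
hom-Γ-χ∅ {m} {a} symA irrA connected = begin
  hom _≟_ (colorful a) (Γ a χ∅)
    ≡⟨ hom-Γ a χ∅ ⟩
  ∑[ M ∈ allMatrices (suc m) ] ⟦ isLabelling a χ∅ M ⟧
    ≡⟨ sumBy-cong (allMatrices (suc m)) (cong ⟦_⟧ ∘ isLabelling-χ∅ symA irrA) ⟩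
  fibre symA irrA (Vec.replicate (suc m) false)
    ≡⟨ 2^-factor E m _ (2^edges≡2^m*fibre₀ symA irrA connected) ⟩
  2 ^ (E ∸ m)
    ≡⟨ cong (λ e → 2 ^ (e ∸ suc m)) (+-comm E 1) ⟨
  2 ^ cycleRank a
    ∎
  where
  open ≡-Reasoning
  E = length (edges a)

1/m*m : ∀ m .{{_ : NonZero m}} → (ℤ.+ 1 / m) *ℚ (ℤ.+ m / 1) ≡ 1ℚ
1/m*m (suc d) = ℚ.toℚᵘ-injective (ℚᵘ.≃-trans (ℚ.toℚᵘ-homo-* (ℤ.+ 1 / suc d) (ℤ.+ suc d / 1))
  (ℚᵘ.≃-trans (ℚᵘ.*-cong (ℚ.toℚᵘ-fromℚᵘ (ℚᵘ.mkℚᵘ (ℤ.+ 1) d)) (ℚ.toℚᵘ-fromℚᵘ (ℚᵘ.mkℚᵘ (ℤ.+ suc d) 0)))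
              (ℚᵘ.*-inverseˡ (ℚᵘ.mkℚᵘ (ℤ.+ suc d) 0))))

-- the left-hand side is homQ _≟_ (colorful a) (X a i j) with h₀ and h₁ for the two homomorphism counts
X-value : (c h₀ h₁ : ℕ) → h₀ ≡ 2 ^ c → h₁ ≡ 0 →
          ((ℤ.+ 1 / 2 ^ c) {{m^n≢0 2 c}} *ℚ (ℤ.+ h₀ / 1))
            +ℚ (((ℤ.- ℤ.+ 1 / 2 ^ c) {{m^n≢0 2 c}} *ℚ (ℤ.+ h₁ / 1)) +ℚ 0ℚ)
          ≡ 1ℚ
X-value c _ _ refl refl = begin
  (1/2ᶜ *ℚ (ℤ.+ 2 ^ c / 1)) +ℚ ((-1/2ᶜ *ℚ 0ℚ) +ℚ 0ℚ)
    ≡⟨ cong₂ _+ℚ_ (1/m*m (2 ^ c) {{m^n≢0 2 c}}) (ℚ.+-identityʳ (-1/2ᶜ *ℚ 0ℚ)) ⟩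
  1ℚ +ℚ (-1/2ᶜ *ℚ 0ℚ)
    ≡⟨ cong (1ℚ +ℚ_) (ℚ.*-zeroʳ -1/2ᶜ) ⟩
  1ℚ +ℚ 0ℚ
    ≡⟨ ℚ.+-identityʳ 1ℚ ⟩
  1ℚ
    ∎
  where
  open ≡-Reasoning
  1/2ᶜ -1/2ᶜ : ℚ
  1/2ᶜ = (ℤ.+ 1 / 2 ^ c) {{m^n≢0 2 c}}
  -1/2ᶜ = (ℤ.- ℤ.+ 1 / 2 ^ c) {{m^n≢0 2 c}}

lemma3p2 : (n : ℕ) (a : Fin n → Fin n → Bool) →
    Symmetric a → Irreflexive a → Connected a →
    (i j : Fin n) → a i j ≡ true →
    homQ _≟_ (colorful a) (X a i j) ≡ 1ℚ
lemma3p2 zero    a _ _ _ () j aij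
lemma3p2 (suc m) a symA irrA connected i j aij =
  X-value (cycleRank a) (hom _≟_ (colorful a) (Γ a χ∅)) (hom _≟_ (colorful a) (Γ a (χ i j)))
          (hom-Γ-χ∅ symA irrA connected) (hom-Γ-χ symA irrA aij)
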